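{- For each $n\equiv 2 \pmod{3}$ with $n\geq 8$, a maximum $(C_6,\overline{C}_6)$-multipacking of $K_n$ has a leave of cardinality $1$. Furthermore, a maximum $(C_6,\overline{C}_6)$-multipacking of $K_7$ has a leave of cardinality $6$, and a maximum $(C_6,\overline{C}_6)$-multipacking of either $K_9$ or $K_{10}$ has a leave of cardinality $3$.
   Context: $C_6$ denotes the cycle on 6 vertices and $\overline{C}_6$ denotes its complement in $K_6$ (two disjoint triangles $\{a,b,c\}$, $\{d,e,f\}$ together with the edges $\{a,d\},\{b,e\},\{c,f\}$; 9 edges). For graphs $G$ and $H$, a $(G,H)$-multipacking of $K_n$ is a collection of edge-disjoint subgraphs of $K_n$, each isomorphic to $G$ or to $H$, containing at least one copy of $G$ and at least one copy of $H$. The leave of a multipacking is the set of edges of $K_n$ not belonging to any subgraph in the collection. A multipacking is maximum if its leave has minimum cardinality among all $(G,H)$-multipackings of $K_n$. -}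

module Defs where

open import Data.Nat using (ℕ; _≤_)
open import Data.Bool using (Bool; true; false; _∧_; _∨_; not; T?)
open import Data.Fin using (Fin; zero; suc; _<_; _≟_)
open import Data.Fin.Properties using (_<?_)
open import Data.List using (List; []; _∷_; length; filter; lookup; allFin; concatMap; map)
open import Data.Bool.ListAction using (any)
open import Data.List.Relation.Unary.Any using (Any)
open import Data.Product using (_×_; _,_; Σ; ∃)
open import Relation.Binary.PropositionalEquality using (_≡_; _≢_)
open import Relation.Nullary.Decidable using (isYes; does)
open import Function.Definitions using (Injective)

v0 v1 v2 v3 v4 v5 : Fin 6
v0 = zero
v1 = suc zero
v2 = suc (suc zero)
v3 = suc (suc (suc zero))
v4 = suc (suc (suc (suc zero)))
v5 = suc (suc (suc (suc (suc zero))))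

-- Pattern graphs on the vertex set Fin 6 = {a,b,c,d,e,f} = {0,...,5}, given by edge lists.

C6-edges : List (Fin 6 × Fin 6)
C6-edges = (v0 , v1) ∷ (v1 , v2) ∷ (v2 , v3) ∷ (v3 , v4) ∷ (v4 , v5) ∷ (v5 , v0) ∷ []

-- C̄₆ : triangles {a,b,c}, {d,e,f} plus edges ad, be, cf (9 edges)
C6bar-edges : List (Fin 6 × Fin 6)
C6bar-edges = (v0 , v1) ∷ (v1 , v2) ∷ (v0 , v2)
            ∷ (v3 , v4) ∷ (v4 , v5) ∷ (v3 , v5)
            ∷ (v0 , v3) ∷ (v1 , v4) ∷ (v2 , v5) ∷ []

data Kind : Set where
  c6 c6bar : Kind

pattern-edges : Kind → List (Fin 6 × Fin 6)
pattern-edges c6    = C6-edges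
pattern-edges c6bar = C6bar-edges

-- A copy of C₆ or C̄₆ in K_n: an injective placement of the 6 pattern vertices.
record Block (n : ℕ) : Set where
  constructor block
  field
    kind  : Kind
    place : Fin 6 → Fin n
    inj   : Injective _≡_ _≡_ place
open Block public

_==_ : ∀ {n} → Fin n → Fin n → Bool
x == y = does (x ≟ y)

covers : ∀ {n} → Block n → Fin n → Fin n → Bool
covers b u v = any (λ { (x , y) →
  ((place b x == u) ∧ (place b y == v)) ∨ ((place b x == v) ∧ (place b y == u)) })
  (pattern-edges (kind b))

edges : (n : ℕ) → List (Fin n × Fin n)
edges n = concatMap (λ i → map (i ,_) (filter (λ j → i <? j) (allFin n))) (allFin n)

record Multipacking (n : ℕ) : Set where
  field
    blocks   : List (Block n)
    disjoint : ∀ (p q : Fin (length blocks)) → p ≢ q → ∀ (u v : Fin n) →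
               covers (lookup blocks p) u v ≡ true →
               covers (lookup blocks q) u v ≡ false
    hasC6    : Any (λ b → kind b ≡ c6) blocks
    hasC6bar : Any (λ b → kind b ≡ c6bar) blocks
open Multipacking public

coveredBy : ∀ {n} → List (Block n) → Fin n → Fin n → Bool
coveredBy bs u v = any (λ b → covers b u v) bs

leave : ∀ {n} → Multipacking n → List (Fin n × Fin n)
leave {n} M = filter (λ { (u , v) → T? (not (coveredBy (blocks M) u v)) }) (edges n)

leaveSize : ∀ {n} → Multipacking n → ℕ
leaveSize M = length (leave M)

-- a maximum (C₆, C̄₆)-multipacking of K_n has a leave of cardinality k:
-- k is attained, and is the minimum over all multipackings
MaxLeave : ℕ → ℕ → Set
MaxLeave n k = Σ (Multipacking n) (λ M → leaveSize M ≡ k)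
             × (∀ (M : Multipacking n) → k ≤ leaveSize M)

-- The argument rests on two identities for a multipacking M of K_n.
--  * Edge count (leave+size≡edges, edge-count): the leave and the blocks partition
--    the edges, |leave| + 6·#C₆ + 9·#C̄₆ = |E(K_n)|.
--  * Degree count (degree-identity): if the leave is empty, every vertex w has
--    n - 1 = 2·(#C₆ through w) + 3·(#C̄₆ through w), since C₆ is 2-regular and
--    C̄₆ is 3-regular.  For n ≡ 2 (mod 3) the edge count is 1 modulo 3, so the leave is
-- non-empty.  For n = 7, 9, 10 the edge count leaves only a few block counts with a
-- smaller leave, each refuted by the degree count combined with the pigeonhole
-- principle or a local pigeonhole principle (blocks lying on the vertices of a
-- disjoint host block must fit their edges at a vertex into the host's non-edges).  Explicit multipackings, checked by computation, for K_7, K_8, K_9,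
-- K_10, K_11, and a step K_n ↦ K_{n+6} adding a decomposition of K_6 ∪ K_{6,n};
-- by the edge count this step keeps the leave.
module Submission where

open import Defs
open import Data.Nat using (ℕ; zero; suc; _+_; _*_; _∸_; _≤_; _<_; _%_; _/_; z≤n; s≤s; NonZero; _≤?_; _<?_; _≟_)
import Data.Nat.Properties as ℕₚ
open import Data.Nat.DivMod using (m≡m%n+[m/n]*n; [m+kn]%n≡m%n; m*n%n≡0)
open import Data.Nat.ListAction using (sum)
open import Data.Nat.ListAction.Properties using (sum-++)
open import Data.Nat.Tactic.RingSolver using (solve-∀)
open import Data.Bool using (Bool; true; false; _∧_; _∨_; not; T; T?; if_then_else_)
import Data.Bool.Properties as Boolₚ
open import Data.Bool.ListAction using (any)
open import Data.Fin as F using (Fin; zero; suc; toℕ; #_; _↑ˡ_; _↑ʳ_)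
import Data.Fin.Properties as Fₚ
open import Data.Vec as Vec using (Vec; _∷_; [])
open import Data.List using (List; []; _∷_; length; filter; lookup; allFin; concatMap; map; _++_; tabulate)
import Data.List.Properties as Lₚ
open import Data.List.Relation.Unary.Any as Any using (Any; here; there)
import Data.List.Relation.Unary.Any.Properties as Anyₚ
open import Data.List.Relation.Unary.All as All using (All; []; _∷_)
import Data.List.Relation.Unary.All.Properties as Allₚ
open import Data.List.Relation.Unary.AllPairs as AllPairs using (AllPairs; []; _∷_)
import Data.List.Relation.Unary.AllPairs.Properties as AllPairsₚ
open import Data.List.Relation.Unary.Unique.Propositional using (Unique)
import Data.List.Relation.Unary.Unique.Propositional.Properties as Uniqueₚ
open import Data.List.Membership.Propositional using (_∈_; find)
open import Data.List.Membership.Propositional.Properties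
open import Data.Product using (_×_; _,_; ∃; proj₁; proj₂; Σ-syntax)
open import Data.Product.Properties using (≡-dec; ,-injective)
open import Data.Sum using (_⊎_; inj₁; inj₂)
open import Data.Empty using (⊥; ⊥-elim)
open import Data.Unit using (tt; ⊤)
open import Function.Definitions using (Injective)
open import Relation.Binary.PropositionalEquality
open import Relation.Binary.Definitions using (DecidableEquality; tri<; tri≈; tri>)
open import Relation.Nullary using (¬_; Dec; yes; no; does)
open import Relation.Nullary.Decidable using (True; toWitness; dec-true; ¬?; _×-dec_; _⊎-dec_; _→-dec_)
open import Relation.Unary using (Decidable)

any-sound : {A : Set} (p : A → Bool) (xs : List A) → any p xs ≡ true → Σ[ x ∈ A ] (x ∈ xs × p x ≡ true)
any-sound p (x ∷ xs) h with p x in px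
... | true  = x , here refl , px
... | false with any-sound p xs h
...   | y , m , py = y , there m , py

any-complete : {A : Set} (p : A → Bool) {xs : List A} {x : A} → x ∈ xs → p x ≡ true → any p xs ≡ true
any-complete p {y ∷ xs} (here refl) px rewrite px = refl
any-complete p {y ∷ xs} (there m) px with p y
... | true  = refl
... | false = any-complete p m px

bool-ext : {a b : Bool} → (a ≡ true → b ≡ true) → (b ≡ true → a ≡ true) → a ≡ b
bool-ext {true}  {true}  _ _ = refl
bool-ext {true}  {false} f _ = sym (f refl)
bool-ext {false} {true}  _ g = g refl
bool-ext {false} {false} _ _ = refl

true≢false : true ≢ false
true≢false ()

∧-intro : ∀ {a b} → a ≡ true → b ≡ true → a ∧ b ≡ true
∧-intro refl refl = refl

==-sound : ∀ {n} {x y : Fin n} → (x == y) ≡ true → x ≡ y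
==-sound {x = x} {y} h with x F.≟ y
... | yes x≡y = x≡y

==-refl : ∀ {n} (x : Fin n) → (x == x) ≡ true
==-refl x with x F.≟ x
... | yes _  = refl
... | no x≢x = ⊥-elim (x≢x refl)

count : {A : Set} → (A → Bool) → List A → ℕ
count p [] = 0
count p (x ∷ xs) = if p x then suc (count p xs) else count p xs

module _ {A : Set} where

  length-filter : {P : A → Set} (P? : Decidable P) (xs : List A) →
                  length (filter P? xs) ≡ count (λ x → does (P? x)) xs
  length-filter P? [] = refl
  length-filter P? (x ∷ xs) with does (P? x)
  ... | true  = cong suc (length-filter P? xs)
  ... | false = length-filter P? xs

  count-cong : (p q : A → Bool) (xs : List A) → (∀ x → x ∈ xs → p x ≡ q x) → count p xs ≡ count q xs
  count-cong p q [] h = refl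
  count-cong p q (x ∷ xs) h with p x | q x | h x (here refl)
  ... | true  | .true  | refl = cong suc (count-cong p q xs (λ y m → h y (there m)))
  ... | false | .false | refl = count-cong p q xs (λ y m → h y (there m))

  count-not : (p : A → Bool) (xs : List A) → count (λ x → not (p x)) xs + count p xs ≡ length xs
  count-not p [] = refl
  count-not p (x ∷ xs) with p x
  ... | true  = trans (ℕₚ.+-suc _ _) (cong suc (count-not p xs))
  ... | false = cong suc (count-not p xs)

  count-∨ : (p q : A → Bool) (xs : List A) → (∀ x → x ∈ xs → p x ≡ true → q x ≡ false) →
            count (λ x → p x ∨ q x) xs ≡ count p xs + count q xs
  count-∨ p q [] h = refl
  count-∨ p q (x ∷ xs) h with p x in px
  ... | true rewrite h x (here refl) px = cong suc (count-∨ p q xs (λ y m → h y (there m)))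
  ... | false with q x
  ...   | true  = trans (cong suc (count-∨ p q xs (λ y m → h y (there m)))) (sym (ℕₚ.+-suc _ _))
  ...   | false = count-∨ p q xs (λ y m → h y (there m))

  count-none : (p : A → Bool) (xs : List A) → (∀ x → x ∈ xs → p x ≡ false) → count p xs ≡ 0
  count-none p [] h = refl
  count-none p (x ∷ xs) h rewrite h x (here refl) = count-none p xs (λ y m → h y (there m))

  count≡0 : (p : A → Bool) (xs : List A) → count p xs ≡ 0 → ∀ x → x ∈ xs → p x ≡ false
  count≡0 p (y ∷ xs) h x m with p y in py
  count≡0 p (y ∷ xs) () x m | true
  ... | false with m
  ...   | here refl = py
  ...   | there m′  = count≡0 p xs h x m′

  count-map : {B : Set} (p : B → Bool) (f : A → B) (xs : List A) → count p (map f xs) ≡ count (λ x → p (f x)) xs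
  count-map p f [] = refl
  count-map p f (x ∷ xs) with p (f x)
  ... | true  = cong suc (count-map p f xs)
  ... | false = count-map p f xs

  count-mono : (p q : A → Bool) (xs : List A) → (∀ x → x ∈ xs → p x ≡ true → q x ≡ true) → count p xs ≤ count q xs
  count-mono p q [] h = z≤n
  count-mono p q (x ∷ xs) h with p x in px | q x in qx
  ... | true  | true  = s≤s (count-mono p q xs (λ y m → h y (there m)))
  ... | true  | false with trans (sym (h x (here refl) px)) qx
  ...   | ()
  count-mono p q (x ∷ xs) h | false | true  = ℕₚ.m≤n⇒m≤1+n (count-mono p q xs (λ y m → h y (there m)))
  count-mono p q (x ∷ xs) h | false | false = count-mono p q xs (λ y m → h y (there m))

  count-∧≤ : (p q : A → Bool) (xs : List A) → count (λ x → p x ∧ q x) xs ≤ count p xs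
  count-∧≤ p q xs = count-mono _ p xs (λ x _ h → ∧-elimˡ h)
    where
    ∧-elimˡ : ∀ {a b} → a ∧ b ≡ true → a ≡ true
    ∧-elimˡ {true} _ = refl

  count-∧-full : (p q : A → Bool) (xs : List A) → count (λ x → p x ∧ q x) xs ≡ count p xs →
                 ∀ x → x ∈ xs → p x ≡ true → q x ≡ true
  count-∧-full p q (y ∷ xs) h x m px with p y in py | q y in qy
  ... | true | true with m
  ...   | here refl = qy
  ...   | there m′  = count-∧-full p q xs (ℕₚ.suc-injective h) x m′ px
  count-∧-full p q (y ∷ xs) h x m px | true | false =
    ⊥-elim (ℕₚ.<-irrefl refl (subst (_≤ count p xs) h (count-∧≤ p q xs)))
  count-∧-full p q (y ∷ xs) h x (here refl) px | false | _ with trans (sym py) px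
  ... | ()
  count-∧-full p q (y ∷ xs) h x (there m′) px | false | _ = count-∧-full p q xs h x m′ px

  count-pos : (p : A → Bool) (xs : List A) (x : A) → x ∈ xs → p x ≡ true → 1 ≤ count p xs
  count-pos p (y ∷ xs) x (here refl) px rewrite px = s≤s z≤n
  count-pos p (y ∷ xs) x (there m) px with p y
  ... | true  = s≤s z≤n
  ... | false = count-pos p xs x m px

  some-of : (p : A → Bool) (xs : List A) → 1 ≤ count p xs → Σ[ x ∈ A ] (x ∈ xs × p x ≡ true)
  some-of p (x ∷ xs) h with p x in px
  ... | true  = x , here refl , px
  ... | false with some-of p xs h
  ...   | y , m , py = y , there m , py

  pair-of : ∀ {R : A → A → Set} (p : A → Bool) {xs : List A} → AllPairs R xs → 2 ≤ count p xs →
            Σ[ x ∈ A ] Σ[ y ∈ A ] (x ∈ xs × y ∈ xs × p x ≡ true × p y ≡ true × R x y)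
  pair-of p {x ∷ xs} (Rx ∷ R-xs) h with p x in px
  pair-of p {x ∷ xs} (Rx ∷ R-xs) (s≤s h) | true with some-of p xs h
  ... | y , my , py = x , y , here refl , there my , px , py , All.lookup Rx my
  pair-of p {x ∷ xs} (Rx ∷ R-xs) h | false with pair-of p R-xs h
  ... | y , z , my , mz , py , pz , r = y , z , there my , there mz , py , pz , r

  triple-of : ∀ {R : A → A → Set} (p : A → Bool) {xs : List A} → AllPairs R xs → 3 ≤ count p xs →
              Σ[ x ∈ A ] Σ[ y ∈ A ] Σ[ z ∈ A ] (x ∈ xs × y ∈ xs × z ∈ xs ×
                p x ≡ true × p y ≡ true × p z ≡ true × R x y × R x z × R y z)
  triple-of p {x ∷ xs} (Rx ∷ R-xs) h with p x in px
  triple-of p {x ∷ xs} (Rx ∷ R-xs) (s≤s h) | true with pair-of p R-xs h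
  ... | y , z , my , mz , py , pz , r =
    x , y , z , here refl , there my , there mz , px , py , pz , All.lookup Rx my , All.lookup Rx mz , r
  triple-of p {x ∷ xs} (Rx ∷ R-xs) h | false with triple-of p R-xs h
  ... | y , z , w , my , mz , mw , py , pz , pw , r₁ , r₂ , r₃ =
    y , z , w , there my , there mz , there mw , py , pz , pw , r₁ , r₂ , r₃

module Membership {A : Set} (_≟_ : DecidableEquality A) where

  member : List A → A → Bool
  member D x = any (λ d → does (x ≟ d)) D

  member-sound : ∀ D x → member D x ≡ true → x ∈ D
  member-sound (d ∷ D) x h with x ≟ d
  ... | yes x≡d = here x≡d
  ... | no _    = there (member-sound D x h)

  member-complete : ∀ D x → x ∈ D → member D x ≡ true
  member-complete (d ∷ D) x (here refl) with x ≟ x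
  ... | yes _  = refl
  ... | no x≢x = ⊥-elim (x≢x refl)
  member-complete (d ∷ D) x (there m) with x ≟ d
  ... | yes _ = refl
  ... | no _  = member-complete D x m

  count-occurrence : (xs : List A) → Unique xs → ∀ d → d ∈ xs → count (λ x → does (x ≟ d)) xs ≡ 1
  count-occurrence (x ∷ xs) (x∉xs ∷ _) d (here refl) with x ≟ x
  ... | no x≢x = ⊥-elim (x≢x refl)
  ... | yes _  = cong suc (count-none _ xs λ y m → lem y (λ y≡x → All.lookup x∉xs m (sym y≡x)))
    where
    lem : ∀ y → y ≢ x → does (y ≟ x) ≡ false
    lem y y≢x with y ≟ x
    ... | yes y≡x = ⊥-elim (y≢x y≡x)
    ... | no _    = refl
  count-occurrence (x ∷ xs) (x∉xs ∷ u) d (there m) with x ≟ d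
  ... | yes refl = ⊥-elim (All.lookup x∉xs m refl)
  ... | no _     = count-occurrence xs u d m

  count-member : (L D : List A) → Unique L → Unique D → (∀ d → d ∈ D → d ∈ L) → count (member D) L ≡ length D
  count-member L [] uL uD sub = count-none _ L (λ _ _ → refl)
  count-member L (d ∷ D) uL (d∉D ∷ uD) sub =
    trans (count-∨ (λ x → does (x ≟ d)) (member D) L exclusive)
          (cong₂ _+_ (count-occurrence L uL d (sub d (here refl)))
                     (count-member L D uL uD (λ d′ m → sub d′ (there m))))
    where
    exclusive : ∀ x → x ∈ L → does (x ≟ d) ≡ true → member D x ≡ false
    exclusive x _ h with x ≟ d | member D x in mx
    ... | yes refl | true  = ⊥-elim (All.lookup d∉D (member-sound D x mx) refl)
    ... | yes refl | false = refl

  length≤count : (L Z : List A) (q : A → Bool) → Unique L → Unique Z → (∀ z → z ∈ Z → z ∈ L) →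
                 (∀ z → z ∈ Z → q z ≡ true) → length Z ≤ count q L
  length≤count L Z q uL uZ sub h =
    subst (_≤ count q L) (count-member L Z uL uZ sub)
          (count-mono (member Z) q L (λ x _ e → h x (member-sound Z x e)))

row : ∀ {n} → Fin n → List (Fin n × Fin n)
row {n} i = map (i ,_) (filter (i Fₚ.<?_) (allFin n))

∈-edges⁺ : ∀ {n} (i j : Fin n) → i F.< j → (i , j) ∈ edges n
∈-edges⁺ {n} i j i<j =
  ∈-concatMap⁺ row (Any.map (λ { refl → ∈-map⁺ (i ,_) (∈-filter⁺ (i Fₚ.<?_) (∈-allFin j) i<j) }) (∈-allFin i))

∈-edges⁻ : ∀ {n} (i j : Fin n) → (i , j) ∈ edges n → i F.< j
∈-edges⁻ {n} i j m with Any.satisfied (∈-concatMap⁻ row {xs = allFin n} m)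
... | k , m′ with ∈-map⁻ (k ,_) {xs = filter (k Fₚ.<?_) (allFin n)} m′
... | _ , m″ , refl = proj₂ (∈-filter⁻ (k Fₚ.<?_) {xs = allFin n} m″)

edges-unique : ∀ n → Unique (edges n)
edges-unique n = Uniqueₚ.concat⁺ {xss = map row (allFin n)}
  (Allₚ.map⁺ (All.tabulate λ {i} _ →
     Uniqueₚ.map⁺ (λ e → proj₂ (,-injective e)) (Uniqueₚ.filter⁺ (i Fₚ.<?_) (Uniqueₚ.allFin⁺ n))))
  (AllPairsₚ.map⁺ (AllPairs.map rows-disjoint (Uniqueₚ.allFin⁺ n)))
  where
  rows-disjoint : ∀ {i k} → i ≢ k → ∀ {e} → e ∈ row i × e ∈ row k → ⊥
  rows-disjoint {i} {k} i≢k (m₁ , m₂) with ∈-map⁻ (i ,_) m₁ | ∈-map⁻ (k ,_) m₂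
  ... | _ , _ , refl | _ , _ , e = i≢k (proj₁ (,-injective e))

-- |E(K_{n+1})| = n + |E(K_n)|: the new first row has n entries, the others are
-- the rows of K_n shifted by one.
edges-suc : ∀ n → length (edges (suc n)) ≡ n + length (edges n)
edges-suc n = begin
  length (edges (suc n))
    ≡⟨ length-rows (suc n) ⟩
  length (row {suc n} zero) + sum (tabulate λ i → length (row {suc n} (suc i)))
    ≡⟨ cong₂ _+_ (trans (length-row {suc n} zero) (first-row n (λ i → i)))
                 (cong sum (Lₚ.tabulate-cong {n = n} λ i → trans (length-row (suc i))
                   (trans (shifted-row i (λ j → j)) (sym (length-row i))))) ⟩
  n + sum (tabulate λ i → length (row {n} i))
    ≡⟨ cong (n +_) (sym (length-rows n)) ⟩
  n + length (edges n) ∎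
  where
  open ≡-Reasoning
  length-concatMap : {A B : Set} (f : A → List B) (xs : List A) → length (concatMap f xs) ≡ sum (map (λ x → length (f x)) xs)
  length-concatMap f [] = refl
  length-concatMap f (x ∷ xs) = trans (Lₚ.length-++ (f x)) (cong (length (f x) +_) (length-concatMap f xs))
  length-rows : ∀ m → length (edges m) ≡ sum (tabulate λ i → length (row {m} i))
  length-rows m = trans (length-concatMap row (allFin m)) (cong sum (Lₚ.map-tabulate (λ i → i) (λ i → length (row {m} i))))
  length-row : ∀ {m} (i : Fin m) → length (row i) ≡ count (λ j → does (i Fₚ.<? j)) (allFin m)
  length-row {m} i = trans (Lₚ.length-map (i ,_) (filter (i Fₚ.<?_) (allFin m))) (length-filter (i Fₚ.<?_) (allFin m))
  first-row : ∀ {k} m (h : Fin m → Fin k) → count (λ j → does (Fₚ._<?_ {suc k} zero j)) (tabulate (λ i → suc (h i))) ≡ m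
  first-row zero h = refl
  first-row (suc m) h = cong suc (first-row m (λ i → h (suc i)))
  shifted-row : ∀ {m k} (i : Fin k) (h : Fin m → Fin k) →
    count (λ j → does (suc i Fₚ.<? j)) (tabulate (λ x → suc (h x))) ≡ count (λ j → does (i Fₚ.<? j)) (tabulate h)
  shifted-row {zero} i h = refl
  shifted-row {suc m} i h with does (i Fₚ.<? h zero)
  ... | true  = cong suc (shifted-row i (λ x → h (suc x)))
  ... | false = shifted-row i (λ x → h (suc x))

PlacedOn : ∀ {n} → Block n → Fin n → Fin n → Fin 6 × Fin 6 → Set
PlacedOn b u v (x , y) = (place b x ≡ u × place b y ≡ v) ⊎ (place b x ≡ v × place b y ≡ u)

covers-sound : ∀ {n} (b : Block n) u v → covers b u v ≡ true →
               Σ[ e ∈ Fin 6 × Fin 6 ] (e ∈ pattern-edges (kind b) × PlacedOn b u v e)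
covers-sound b u v h with any-sound _ (pattern-edges (kind b)) h
... | (x , y) , m , hit = (x , y) , m , decode hit
  where
  decode : ((place b x == u) ∧ (place b y == v)) ∨ ((place b x == v) ∧ (place b y == u)) ≡ true → PlacedOn b u v (x , y)
  decode h with place b x == u in xu | place b y == v in yv | place b x == v in xv | place b y == u in yu
  ... | true  | true  | _     | _    = inj₁ (==-sound xu , ==-sound yv)
  ... | true  | false | true  | true = inj₂ (==-sound xv , ==-sound yu)
  ... | false | _     | true  | true = inj₂ (==-sound xv , ==-sound yu)

covers-complete : ∀ {n} (b : Block n) u v e → e ∈ pattern-edges (kind b) → PlacedOn b u v e → covers b u v ≡ true
covers-complete b u v (x , y) m placed = any-complete _ m (encode placed)
  where
  encode : PlacedOn b u v (x , y) → ((place b x == u) ∧ (place b y == v)) ∨ ((place b x == v) ∧ (place b y == u)) ≡ true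
  encode (inj₁ (refl , refl)) rewrite ==-refl (place b x) | ==-refl (place b y) = refl
  encode (inj₂ (refl , refl)) rewrite ==-refl (place b x) | ==-refl (place b y) = Boolₚ.∨-zeroʳ _

covers-sym : ∀ {n} (b : Block n) u v → covers b u v ≡ covers b v u
covers-sym b u v = bool-ext (flip u v) (flip v u)
  where
  flip : ∀ u v → covers b u v ≡ true → covers b v u ≡ true
  flip u v h with covers-sound b u v h
  ... | e , m , inj₁ (p , q) = covers-complete b v u e m (inj₂ (p , q))
  ... | e , m , inj₂ (p , q) = covers-complete b v u e m (inj₁ (p , q))

loopless : ∀ k → All (λ e → proj₁ e ≢ proj₂ e) (pattern-edges k)
loopless c6    = (λ ()) ∷ (λ ()) ∷ (λ ()) ∷ (λ ()) ∷ (λ ()) ∷ (λ ()) ∷ []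
loopless c6bar = (λ ()) ∷ (λ ()) ∷ (λ ()) ∷ (λ ()) ∷ (λ ()) ∷ (λ ()) ∷ (λ ()) ∷ (λ ()) ∷ (λ ()) ∷ []

_≟²_ : ∀ {n} → DecidableEquality (Fin n × Fin n)
_≟²_ = ≡-dec F._≟_ F._≟_

DistinctEdges : Fin 6 × Fin 6 → Fin 6 × Fin 6 → Set
DistinctEdges (x , y) e = (x , y) ≢ e × (y , x) ≢ e

distinct-edges? : ∀ e e′ → Dec (DistinctEdges e e′)
distinct-edges? (x , y) e = ¬? ((x , y) ≟² e) ×-dec ¬? ((y , x) ≟² e)

simple : ∀ k → AllPairs DistinctEdges (pattern-edges k)
simple k = toWitness {a? = AllPairs.allPairs? distinct-edges? (pattern-edges k)} (check k)
  where
  check : ∀ k → True (AllPairs.allPairs? distinct-edges? (pattern-edges k))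
  check c6    = _
  check c6bar = _

covers-irrefl : ∀ {n} (b : Block n) u → covers b u u ≡ false
covers-irrefl b u with covers b u u in h
... | false = refl
... | true with covers-sound b u u h
...   | e , m , inj₁ (p , q) = ⊥-elim (All.lookup (loopless (kind b)) m (inj b (trans p (sym q))))
...   | e , m , inj₂ (p , q) = ⊥-elim (All.lookup (loopless (kind b)) m (inj b (trans p (sym q))))

ordered : ∀ {n} → Fin n → Fin n → Fin n × Fin n
ordered a c with a Fₚ.<? c
... | yes _ = (a , c)
... | no _  = (c , a)

ordered-sound : ∀ {n} (a c u v : Fin n) → ordered a c ≡ (u , v) → (a ≡ u × c ≡ v) ⊎ (a ≡ v × c ≡ u)
ordered-sound a c u v h with a Fₚ.<? c
ordered-sound a c .a .c refl | yes _ = inj₁ (refl , refl)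
ordered-sound a c .c .a refl | no _  = inj₂ (refl , refl)

ordered-complete : ∀ {n} (a c u v : Fin n) → u F.< v → (a ≡ u × c ≡ v) ⊎ (a ≡ v × c ≡ u) → ordered a c ≡ (u , v)
ordered-complete a c u v u<v (inj₁ (refl , refl)) with a Fₚ.<? c
... | yes _   = refl
... | no a≮c  = ⊥-elim (a≮c u<v)
ordered-complete a c u v u<v (inj₂ (refl , refl)) with a Fₚ.<? c
... | yes a<c = ⊥-elim (Fₚ.<-asym u<v a<c)
... | no _    = refl

ordered-increasing : ∀ {n} (a c : Fin n) → a ≢ c → proj₁ (ordered a c) F.< proj₂ (ordered a c)
ordered-increasing a c a≢c with a Fₚ.<? c
... | yes a<c = a<c
... | no a≮c  = Fₚ.≤∧≢⇒< (ℕₚ.≮⇒≥ a≮c) (λ e → a≢c (sym e))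

ordered-injective : ∀ {n} (a c a′ c′ : Fin n) → ordered a c ≡ ordered a′ c′ →
                    (a ≡ a′ × c ≡ c′) ⊎ (a ≡ c′ × c ≡ a′)
ordered-injective a c a′ c′ h with ordered-sound a c _ _ h | ordered-sound a′ c′ _ _ refl
... | inj₁ (p , q) | inj₁ (r , s) = inj₁ (trans p (sym r) , trans q (sym s))
... | inj₁ (p , q) | inj₂ (r , s) = inj₂ (trans p (sym s) , trans q (sym r))
... | inj₂ (p , q) | inj₁ (r , s) = inj₂ (trans p (sym s) , trans q (sym r))
... | inj₂ (p , q) | inj₂ (r , s) = inj₁ (trans p (sym r) , trans q (sym s))

block-edges : ∀ {n} → Block n → List (Fin n × Fin n)
block-edges b = map (λ e → ordered (place b (proj₁ e)) (place b (proj₂ e))) (pattern-edges (kind b))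

block-edges-unique : ∀ {n} (b : Block n) → Unique (block-edges b)
block-edges-unique b = AllPairsₚ.map⁺ (AllPairs.map distinct (simple (kind b)))
  where
  distinct : ∀ {e e′ : Fin 6 × Fin 6} → DistinctEdges e e′ →
             ordered (place b (proj₁ e)) (place b (proj₂ e)) ≢ ordered (place b (proj₁ e′)) (place b (proj₂ e′))
  distinct {x , y} {x′ , y′} (d₁ , d₂) h with ordered-injective _ _ _ _ h
  ... | inj₁ (p , q) = d₁ (cong₂ _,_ (inj b p) (inj b q))
  ... | inj₂ (p , q) = d₂ (cong₂ _,_ (inj b q) (inj b p))

block-edges⊆edges : ∀ {n} (b : Block n) e → e ∈ block-edges b → e ∈ edges n
block-edges⊆edges b e m with ∈-map⁻ (λ e → ordered (place b (proj₁ e)) (place b (proj₂ e))) m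
... | (x , y) , m′ , refl =
  ∈-edges⁺ _ _ (ordered-increasing (place b x) (place b y) (λ e → All.lookup (loopless (kind b)) m′ (inj b e)))

covers≡member : ∀ {n} (b : Block n) u v → u F.< v → covers b u v ≡ Membership.member _≟²_ (block-edges b) (u , v)
covers≡member b u v u<v = bool-ext to from
  where
  open Membership _≟²_
  to : covers b u v ≡ true → member (block-edges b) (u , v) ≡ true
  to h with covers-sound b u v h
  ... | e , m , placed = member-complete (block-edges b) (u , v)
          (subst (_∈ block-edges b) (ordered-complete _ _ u v u<v placed)
                 (∈-map⁺ (λ e → ordered (place b (proj₁ e)) (place b (proj₂ e))) m))
  from : member (block-edges b) (u , v) ≡ true → covers b u v ≡ true
  from h with ∈-map⁻ (λ e → ordered (place b (proj₁ e)) (place b (proj₂ e))) (member-sound (block-edges b) (u , v) h)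
  ... | e , m , eq = covers-complete b u v e m (ordered-sound _ _ u v (sym eq))

coversEdge : ∀ {n} → Block n → Fin n × Fin n → Bool
coversEdge b (u , v) = covers b u v

count-covered : ∀ {n} (b : Block n) → count (coversEdge b) (edges n) ≡ length (pattern-edges (kind b))
count-covered {n} b = begin
  count (coversEdge b) (edges n)
    ≡⟨ count-cong _ _ (edges n) (λ { (u , v) m → covers≡member b u v (∈-edges⁻ u v m) }) ⟩
  count (member (block-edges b)) (edges n)
    ≡⟨ count-member (edges n) (block-edges b) (edges-unique n) (block-edges-unique b) (block-edges⊆edges b) ⟩
  length (block-edges b)
    ≡⟨ Lₚ.length-map _ (pattern-edges (kind b)) ⟩
  length (pattern-edges (kind b)) ∎
  where
  open ≡-Reasoning
  open Membership _≟²_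

Disjoint : ∀ {n} → Block n → Block n → Set
Disjoint b c = ∀ u v → covers b u v ≡ true → covers c u v ≡ false

Disjoint-sym : ∀ {n} {b c : Block n} → Disjoint b c → Disjoint c b
Disjoint-sym {b = b} {c} d u v h with covers b u v in e
... | false = refl
... | true with trans (sym h) (d u v e)
...   | ()

pairwise-disjoint : ∀ {n} (M : Multipacking n) → AllPairs Disjoint (blocks M)
pairwise-disjoint M = from-indices (blocks M) (disjoint M)
  where
  from-indices : ∀ {n} (xs : List (Block n)) → (∀ (p q : Fin (length xs)) → p ≢ q → Disjoint (lookup xs p) (lookup xs q)) →
                 AllPairs Disjoint xs
  from-indices [] h = []
  from-indices (x ∷ xs) h =
    All.tabulate (λ m → subst (Disjoint x) (sym (Anyₚ.lookup-index m)) (h zero (suc (Any.index m)) (λ ())))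
    ∷ from-indices xs (λ p q p≢q → h (suc p) (suc q) (λ e → p≢q (Fₚ.suc-injective e)))

multipacking : ∀ {n} (bs : List (Block n)) → AllPairs Disjoint bs →
               Any (λ b → kind b ≡ c6) bs → Any (λ b → kind b ≡ c6bar) bs → Multipacking n
multipacking bs ap has₁ has₂ = record
  { blocks = bs ; disjoint = to-indices ap ; hasC6 = has₁ ; hasC6bar = has₂ }
  where
  to-indices : ∀ {xs} → AllPairs Disjoint xs → ∀ (p q : Fin (length xs)) → p ≢ q → Disjoint (lookup xs p) (lookup xs q)
  to-indices (a ∷ ap) zero    zero    p≢q = ⊥-elim (p≢q refl)
  to-indices (a ∷ ap) zero    (suc q) _   = All.lookup a (∈-lookup q)
  to-indices {x ∷ xs} (a ∷ ap) (suc p) zero _ = Disjoint-sym {b = x} {c = lookup xs p} (All.lookup a (∈-lookup p))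
  to-indices (a ∷ ap) (suc p) (suc q) p≢q = to-indices ap p q (λ e → p≢q (cong suc e))

size : Kind → ℕ
size c6    = 6
size c6bar = 9

length-pattern : ∀ k → length (pattern-edges k) ≡ size k
length-pattern c6    = refl
length-pattern c6bar = refl

totalSize : ∀ {n} → List (Block n) → ℕ
totalSize bs = sum (map (λ b → size (kind b)) bs)

coveredEdge : ∀ {n} → List (Block n) → Fin n × Fin n → Bool
coveredEdge bs (u , v) = coveredBy bs u v

count-coveredBy : ∀ {n} (bs : List (Block n)) (L : List (Fin n × Fin n)) → AllPairs Disjoint bs →
                  count (coveredEdge bs) L ≡ sum (map (λ b → count (coversEdge b) L) bs)
count-coveredBy [] L _ = count-none _ L (λ _ _ → refl)
count-coveredBy (b ∷ bs) L (b-disj ∷ ap) =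
  trans (count-∨ (coversEdge b) (coveredEdge bs) L exclusive) (cong (count (coversEdge b) L +_) (count-coveredBy bs L ap))
  where
  exclusive : ∀ e → e ∈ L → coversEdge b e ≡ true → coveredEdge bs e ≡ false
  exclusive (u , v) _ h with coveredBy bs u v in cov
  ... | false = refl
  ... | true with any-sound (λ c → covers c u v) bs cov
  ...   | c , m , hc with trans (sym hc) (All.lookup b-disj m u v h)
  ...     | ()

leaveSize≡count : ∀ {n} (M : Multipacking n) → leaveSize M ≡ count (λ e → not (coveredEdge (blocks M) e)) (edges n)
leaveSize≡count {n} M = trans (length-filter _ (edges n)) (count-cong _ _ (edges n) (λ { (u , v) _ → does-T? _ }))
  where
  does-T? : ∀ b → does (T? b) ≡ b
  does-T? true  = refl
  does-T? false = refl

leave+size≡edges : ∀ {n} (M : Multipacking n) → leaveSize M + totalSize (blocks M) ≡ length (edges n)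
leave+size≡edges {n} M = begin
  leaveSize M + totalSize (blocks M)
    ≡⟨ cong₂ _+_ (leaveSize≡count M)
         (cong sum (Lₚ.map-cong (λ b → sym (trans (count-covered b) (length-pattern (kind b)))) (blocks M))) ⟩
  count (λ e → not (covered e)) (edges n) + sum (map (λ b → count (coversEdge b) (edges n)) (blocks M))
    ≡⟨ cong (count (λ e → not (covered e)) (edges n) +_) (sym (count-coveredBy (blocks M) (edges n) (pairwise-disjoint M))) ⟩
  count (λ e → not (covered e)) (edges n) + count covered (edges n)
    ≡⟨ count-not covered (edges n) ⟩
  length (edges n) ∎
  where
  open ≡-Reasoning
  covered : Fin n × Fin n → Bool
  covered = coveredEdge (blocks M)

injective? : ∀ {n} (p : Fin 6 → Fin n) → Dec (∀ x y → p x ≡ p y → x ≡ y)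
injective? p = Fₚ.all? λ x → Fₚ.all? λ y → (p x F.≟ p y) →-dec (x F.≟ y)

copy : ∀ {n} → Kind → (v : Vec (Fin n) 6) → {True (injective? (Vec.lookup v))} → Block n
copy k v {ok} = block k (Vec.lookup v) (λ {x} {y} → toWitness ok x y)

disjoint? : ∀ {n} (b c : Block n) → Dec (Disjoint b c)
disjoint? b c = Fₚ.all? λ u → Fₚ.all? λ v → (covers b u v Boolₚ.≟ true) →-dec (covers c u v Boolₚ.≟ false)

pairwise-disjoint? : ∀ {n} (bs : List (Block n)) → Dec (AllPairs Disjoint bs)
pairwise-disjoint? = AllPairs.allPairs? disjoint?

-- Blocks supported by incompatible relations are edge-disjoint; this is how
-- disjointness of the pieces of the recursive construction is established.
Supported : ∀ {n} → (Fin n → Fin n → Set) → Block n → Set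
Supported S b = ∀ u v → covers b u v ≡ true → S u v

supported? : ∀ {n} {S : Fin n → Fin n → Set} → (∀ u v → Dec (S u v)) → (b : Block n) → Dec (Supported S b)
supported? S? b = Fₚ.all? λ u → Fₚ.all? λ v → (covers b u v Boolₚ.≟ true) →-dec S? u v

supported-disjoint : ∀ {n} {S S′ : Fin n → Fin n → Set} (xs ys : List (Block n)) →
                     All (Supported S) xs → All (Supported S′) ys → (∀ {u v} → S u v → S′ u v → ⊥) →
                     All (λ b → All (Disjoint b) ys) xs
supported-disjoint {S = S} {S′} xs ys Sxs S′ys S⊥S′ = All.map (λ {b} Sb → All.map (λ {c} S′c → apart b c Sb S′c) S′ys) Sxs
  where
  apart : ∀ b c → Supported S b → Supported S′ c → Disjoint b c
  apart b c Sb S′c u v h with covers c u v in e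
  ... | false = refl
  ... | true  = ⊥-elim (S⊥S′ (Sb u v h) (S′c u v e))

supported-weaken : ∀ {n} {S S′ : Fin n → Fin n → Set} {xs} → (∀ {u v} → S u v → S′ u v) →
                   All (Supported S) xs → All (Supported S′) xs
supported-weaken w = All.map (λ Sb u v h → w (Sb u v h))

↑ˡ-injective : ∀ {m} n → Injective _≡_ _≡_ (λ (i : Fin m) → i ↑ˡ n)
↑ˡ-injective n {i} {j} = Fₚ.↑ˡ-injective n i j

↑ʳ-injective : ∀ {m} n → Injective _≡_ _≡_ (λ (i : Fin m) → n ↑ʳ i)
↑ʳ-injective n {i} {j} = Fₚ.↑ʳ-injective n i j

embed : ∀ {m n} (f : Fin m → Fin n) → Injective _≡_ _≡_ f → Block m → Block n
embed f f-inj b = block (kind b) (λ x → f (place b x)) (λ e → inj b (f-inj e))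

module Embedding {m n} (f : Fin m → Fin n) (f-inj : Injective _≡_ _≡_ f) where

  embed′ : Block m → Block n
  embed′ = embed f f-inj

  covers-image : (b : Block m) (u′ v′ : Fin n) → covers (embed f f-inj b) u′ v′ ≡ true →
                 Σ[ u ∈ Fin m ] Σ[ v ∈ Fin m ] (f u ≡ u′ × f v ≡ v′ × covers b u v ≡ true)
  covers-image b u′ v′ h with covers-sound (embed f f-inj b) u′ v′ h
  ... | (x , y) , m , inj₁ (p , q) = place b x , place b y , p , q , covers-complete b _ _ (x , y) m (inj₁ (refl , refl))
  ... | (x , y) , m , inj₂ (p , q) = place b y , place b x , q , p , covers-complete b _ _ (x , y) m (inj₂ (refl , refl))

  covers-embed : (b : Block m) (u v : Fin m) → covers (embed f f-inj b) (f u) (f v) ≡ covers b u v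
  covers-embed b u v = bool-ext to from
    where
    to : covers (embed f f-inj b) (f u) (f v) ≡ true → covers b u v ≡ true
    to h with covers-image b (f u) (f v) h
    ... | _ , _ , p , q , c rewrite f-inj p | f-inj q = c
    from : covers b u v ≡ true → covers (embed f f-inj b) (f u) (f v) ≡ true
    from h with covers-sound b u v h
    ... | e , m , inj₁ (p , q) = covers-complete (embed f f-inj b) _ _ e m (inj₁ (cong f p , cong f q))
    ... | e , m , inj₂ (p , q) = covers-complete (embed f f-inj b) _ _ e m (inj₂ (cong f p , cong f q))

  embed-disjoint : (bs : List (Block m)) → AllPairs Disjoint bs → AllPairs Disjoint (map (embed f f-inj) bs)
  embed-disjoint bs ap = AllPairsₚ.map⁺ (AllPairs.map (λ {b} {c} → preserve b c) ap)
    where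
    preserve : ∀ b c → Disjoint b c → Disjoint (embed f f-inj b) (embed f f-inj c)
    preserve b c d u′ v′ h with covers-image b u′ v′ h
    ... | u , v , refl , refl , cb = trans (covers-embed c u v) (d u v cb)

  embed-supported : {S : Fin m → Fin m → Set} {S′ : Fin n → Fin n → Set} (bs : List (Block m)) →
                    All (Supported S) bs → (∀ {u v} → S u v → S′ (f u) (f v)) → All (Supported S′) (map (embed f f-inj) bs)
  embed-supported {S} {S′} bs Sbs S⇒S′ = Allₚ.map⁺ (All.map (λ {b} Sb u′ v′ h → transport b Sb u′ v′ h) Sbs)
    where
    transport : ∀ b → Supported S b → ∀ u′ v′ → covers (embed f f-inj b) u′ v′ ≡ true → S′ u′ v′
    transport b Sb u′ v′ h with covers-image b u′ v′ h
    ... | u , v , refl , refl , c = S⇒S′ (Sb u v c)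

  embed-image : (bs : List (Block m)) {S′ : Fin n → Fin n → Set} → (∀ u v → S′ (f u) (f v)) →
                All (Supported S′) (map (embed f f-inj) bs)
  embed-image bs {S′} S′f = embed-supported {S = λ _ _ → ⊤} bs (All.tabulate (λ _ _ _ _ → tt)) (λ {u} {v} _ → S′f u v)

  totalSize-embed : (bs : List (Block m)) → totalSize (map (embed f f-inj) bs) ≡ totalSize bs
  totalSize-embed bs = cong sum (sym (Lₚ.map-∘ bs))

totalSize-++ : ∀ {n} (xs ys : List (Block n)) → totalSize (xs ++ ys) ≡ totalSize xs + totalSize ys
totalSize-++ xs ys = trans (cong sum (Lₚ.map-++ _ xs ys)) (sum-++ (map _ xs) _)

OneEnd : ∀ {n} → (ℕ → Set) → Fin n → Fin n → Set
OneEnd P u v = P (toℕ u) ⊎ P (toℕ v)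

BothEnds : ∀ {n} → (ℕ → Set) → Fin n → Fin n → Set
BothEnds P u v = P (toℕ u) × P (toℕ v)

OneEnd-map : ∀ {m n} (P Q : ℕ → Set) (f : Fin m → Fin n) → (∀ {u} → P (toℕ u) → Q (toℕ (f u))) →
             ∀ {u v} → OneEnd P u v → OneEnd Q (f u) (f v)
OneEnd-map P Q f h (inj₁ p) = inj₁ (h p)
OneEnd-map P Q f h (inj₂ p) = inj₂ (h p)

inside-beyond : ∀ {n} h {u v : Fin n} → BothEnds (_< h) u v → OneEnd (h ≤_) u v → ⊥
inside-beyond h (p , q) (inj₁ r) = ℕₚ.<⇒≱ p r
inside-beyond h (p , q) (inj₂ r) = ℕₚ.<⇒≱ q r

touching-outside : ∀ {n} h {u v : Fin n} → OneEnd (_< h) u v → BothEnds (h ≤_) u v → ⊥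
touching-outside h (inj₁ p) (r , _) = ℕₚ.<⇒≱ p r
touching-outside h (inj₂ p) (_ , r) = ℕₚ.<⇒≱ p r

OneEnd? : ∀ {n} {P : ℕ → Set} → (∀ k → Dec (P k)) → ∀ (u v : Fin n) → Dec (OneEnd P u v)
OneEnd? P? u v = P? (toℕ u) ⊎-dec P? (toℕ v)

Crossing : ∀ {n} → ℕ → Fin n → Fin n → Set
Crossing h u v = OneEnd (_< 6) u v × OneEnd (h ≤_) u v

crossing? : ∀ {n} (u v : Fin n) → Dec (Crossing 6 u v)
crossing? u v = OneEnd? (_<? 6) u v ×-dec OneEnd? (6 ≤?_) u v

-- Inserting a vertices after the first six.
lift : ∀ a {m} → Fin (6 + m) → Fin (6 + (a + m))
lift a zero = zero
lift a (suc zero) = suc zero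
lift a (suc (suc zero)) = suc (suc zero)
lift a (suc (suc (suc zero))) = suc (suc (suc zero))
lift a (suc (suc (suc (suc zero)))) = suc (suc (suc (suc zero)))
lift a (suc (suc (suc (suc (suc zero))))) = suc (suc (suc (suc (suc zero))))
lift a (suc (suc (suc (suc (suc (suc j)))))) = suc (suc (suc (suc (suc (suc (a ↑ʳ j))))))

lift-low : ∀ a {m} (u : Fin (6 + m)) → toℕ u < 6 → toℕ (lift a u) ≡ toℕ u
lift-low a zero _ = refl
lift-low a (suc zero) _ = refl
lift-low a (suc (suc zero)) _ = refl
lift-low a (suc (suc (suc zero))) _ = refl
lift-low a (suc (suc (suc (suc zero)))) _ = refl
lift-low a (suc (suc (suc (suc (suc zero))))) _ = refl
lift-low a (suc (suc (suc (suc (suc (suc j)))))) (s≤s (s≤s (s≤s (s≤s (s≤s (s≤s ()))))))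

lift-high : ∀ a {m} (u : Fin (6 + m)) → 6 ≤ toℕ u → toℕ (lift a u) ≡ a + toℕ u
lift-high a zero ()
lift-high a (suc zero) (s≤s ())
lift-high a (suc (suc zero)) (s≤s (s≤s ()))
lift-high a (suc (suc (suc zero))) (s≤s (s≤s (s≤s ())))
lift-high a (suc (suc (suc (suc zero)))) (s≤s (s≤s (s≤s (s≤s ()))))
lift-high a (suc (suc (suc (suc (suc zero))))) (s≤s (s≤s (s≤s (s≤s (s≤s ())))))
lift-high a (suc (suc (suc (suc (suc (suc j)))))) _ = begin
  6 + toℕ (a ↑ʳ j) ≡⟨ cong (6 +_) (Fₚ.toℕ-↑ʳ a j) ⟩
  6 + (a + toℕ j)  ≡⟨ reassociate 6 a (toℕ j) ⟩
  a + (6 + toℕ j)  ∎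
  where
  open ≡-Reasoning
  reassociate : ∀ x y z → x + (y + z) ≡ y + (x + z)
  reassociate = solve-∀

lift-keeps-low : ∀ a {m} {u : Fin (6 + m)} → toℕ u < 6 → toℕ (lift a u) < 6
lift-keeps-low a {u = u} p = subst (_< 6) (sym (lift-low a u p)) p

lift-shifts-high : ∀ a {m} {h} {u : Fin (6 + m)} → 6 ≤ h → h ≤ toℕ u → h + a ≤ toℕ (lift a u)
lift-shifts-high a {h = h} {u} 6≤h p =
  subst (h + a ≤_) (trans (ℕₚ.+-comm (toℕ u) a) (sym (lift-high a u (ℕₚ.≤-trans 6≤h p)))) (ℕₚ.+-monoˡ-≤ a p)

lift-separates : ∀ a {m} {u v : Fin (6 + m)} → toℕ u < 6 → 6 ≤ toℕ v → lift a u ≢ lift a v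
lift-separates a {u = u} {v} p q e =
  ℕₚ.<⇒≱ (lift-keeps-low a {u = u} p)
         (subst (6 ≤_) (cong toℕ (sym e)) (ℕₚ.≤-trans (ℕₚ.m≤m+n 6 a) (lift-shifts-high a {u = v} ℕₚ.≤-refl q)))

lift-injective : ∀ a {m} → Injective _≡_ _≡_ (lift a {m})
lift-injective a {m} {u} {v} e with toℕ u ℕₚ.<? 6 | toℕ v ℕₚ.<? 6
... | yes p | yes q = Fₚ.toℕ-injective (trans (sym (lift-low a u p)) (trans (cong toℕ e) (lift-low a v q)))
... | yes p | no q  = ⊥-elim (lift-separates a p (ℕₚ.≮⇒≥ q) e)
... | no p  | yes q = ⊥-elim (lift-separates a q (ℕₚ.≮⇒≥ p) (sym e))
... | no p  | no q  = Fₚ.toℕ-injective (ℕₚ.+-cancelˡ-≡ a _ _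
                        (trans (sym (lift-high a u (ℕₚ.≮⇒≥ p))) (trans (cong toℕ e) (lift-high a v (ℕₚ.≮⇒≥ q)))))

-- Decompositions of K_{6,4} and K_{6,6} (parts {0..5} and {6..}) into copies of C₆.
data Chunk : Set where
  four six : Chunk

width : Chunk → ℕ
width four = 4
width six  = 6

chunk-blocks : (c : Chunk) → List (Block (6 + width c))
chunk-blocks four =
    copy c6 (# 0 ∷ # 6 ∷ # 3 ∷ # 7 ∷ # 2 ∷ # 8 ∷ [])
  ∷ copy c6 (# 0 ∷ # 7 ∷ # 1 ∷ # 6 ∷ # 4 ∷ # 9 ∷ [])
  ∷ copy c6 (# 1 ∷ # 8 ∷ # 4 ∷ # 7 ∷ # 5 ∷ # 9 ∷ [])
  ∷ copy c6 (# 2 ∷ # 6 ∷ # 5 ∷ # 8 ∷ # 3 ∷ # 9 ∷ []) ∷ []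
chunk-blocks six =
    copy c6 (# 0 ∷ # 6 ∷ # 2 ∷ # 11 ∷ # 5 ∷ # 9 ∷ [])
  ∷ copy c6 (# 0 ∷ # 7 ∷ # 1 ∷ # 9 ∷ # 2 ∷ # 10 ∷ [])
  ∷ copy c6 (# 0 ∷ # 8 ∷ # 4 ∷ # 9 ∷ # 3 ∷ # 11 ∷ [])
  ∷ copy c6 (# 1 ∷ # 6 ∷ # 3 ∷ # 8 ∷ # 5 ∷ # 10 ∷ [])
  ∷ copy c6 (# 1 ∷ # 8 ∷ # 2 ∷ # 7 ∷ # 4 ∷ # 11 ∷ [])
  ∷ copy c6 (# 3 ∷ # 7 ∷ # 5 ∷ # 6 ∷ # 4 ∷ # 10 ∷ []) ∷ []

chunk-disjoint : ∀ c → AllPairs Disjoint (chunk-blocks c)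
chunk-disjoint four = toWitness {a? = pairwise-disjoint? (chunk-blocks four)} _
chunk-disjoint six  = toWitness {a? = pairwise-disjoint? (chunk-blocks six)} _

chunk-crossing : ∀ c → All (Supported (Crossing 6)) (chunk-blocks c)
chunk-crossing four = toWitness {a? = All.all? (supported? crossing?) (chunk-blocks four)} _
chunk-crossing six  = toWitness {a? = All.all? (supported? crossing?) (chunk-blocks six)} _

chunk-size : ∀ c → totalSize (chunk-blocks c) ≡ width c * 6
chunk-size four = refl
chunk-size six  = refl

totalWidth : List Chunk → ℕ
totalWidth [] = 0
totalWidth (c ∷ cs) = width c + totalWidth cs

-- Decomposition of K_{6,m}, m = totalWidth cs, into copies of C₆: the first chunk
-- occupies vertices 6 .. 5 + width c, the remaining ones are inserted after it.
module CrossingSplit (c : Chunk) (cs : List Chunk) where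

  first : Fin (6 + width c) → Fin (6 + totalWidth (c ∷ cs))
  first u = u ↑ˡ totalWidth cs

  rest : Fin (6 + totalWidth cs) → Fin (6 + totalWidth (c ∷ cs))
  rest = lift (width c)

  module First = Embedding first (↑ˡ-injective (totalWidth cs))
  module Rest  = Embedding rest (lift-injective (width c))

  first-keeps : ∀ (P : ℕ → Set) {u} → P (toℕ u) → P (toℕ (first u))
  first-keeps P {u} = subst P (sym (Fₚ.toℕ-↑ˡ u (totalWidth cs)))

  first-crossing : ∀ {u v} → Crossing 6 u v → Crossing 6 (first u) (first v)
  first-crossing (t , b) = OneEnd-map (_< 6) (_< 6) first (first-keeps (_< 6)) t ,
                           OneEnd-map (6 ≤_) (6 ≤_) first (first-keeps (6 ≤_)) b

  first-inside : ∀ u v → BothEnds (_< 6 + width c) (first u) (first v)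
  first-inside u v = first-keeps (_< 6 + width c) (Fₚ.toℕ<n u) , first-keeps (_< 6 + width c) (Fₚ.toℕ<n v)

  rest-beyond : ∀ {u v} → Crossing 6 u v → OneEnd (6 + width c ≤_) (rest u) (rest v)
  rest-beyond (_ , b) = OneEnd-map (6 ≤_) (6 + width c ≤_) rest (lift-shifts-high (width c) ℕₚ.≤-refl) b

  rest-crossing : ∀ {u v} → Crossing 6 u v → Crossing 6 (rest u) (rest v)
  rest-crossing x =
    OneEnd-map (_< 6) (_< 6) rest (lift-keeps-low (width c)) (proj₁ x) ,
    OneEnd-map (6 + width c ≤_) (6 ≤_) (λ w → w) (ℕₚ.≤-trans (ℕₚ.m≤m+n 6 (width c))) (rest-beyond x)

crossing-blocks : (cs : List Chunk) → List (Block (6 + totalWidth cs))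
crossing-blocks [] = []
crossing-blocks (c ∷ cs) = map First.embed′ (chunk-blocks c) ++ map Rest.embed′ (crossing-blocks cs)
  where open CrossingSplit c cs

crossing-supported : ∀ cs → All (Supported (Crossing 6)) (crossing-blocks cs)
crossing-supported [] = []
crossing-supported (c ∷ cs) = Allₚ.++⁺
  (First.embed-supported (chunk-blocks c) (chunk-crossing c) first-crossing)
  (Rest.embed-supported (crossing-blocks cs) (crossing-supported cs) rest-crossing)
  where open CrossingSplit c cs

-- the first chunk lies below 6 + width c, the shifted rest crosses beyond it
crossing-disjoint : ∀ cs → AllPairs Disjoint (crossing-blocks cs)
crossing-disjoint [] = []
crossing-disjoint (c ∷ cs) = AllPairsₚ.++⁺
  (First.embed-disjoint (chunk-blocks c) (chunk-disjoint c))
  (Rest.embed-disjoint (crossing-blocks cs) (crossing-disjoint cs))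
  (supported-disjoint (map First.embed′ (chunk-blocks c)) (map Rest.embed′ (crossing-blocks cs))
    (First.embed-image (chunk-blocks c) {S′ = BothEnds (_< 6 + width c)} first-inside)
    (Rest.embed-supported {S′ = OneEnd (6 + width c ≤_)} (crossing-blocks cs) (crossing-supported cs) rest-beyond)
    (inside-beyond (6 + width c)))
  where open CrossingSplit c cs

crossing-size : ∀ cs → totalSize (crossing-blocks cs) ≡ totalWidth cs * 6
crossing-size [] = refl
crossing-size (c ∷ cs) = begin
  totalSize (crossing-blocks (c ∷ cs))
    ≡⟨ totalSize-++ (map First.embed′ (chunk-blocks c)) (map Rest.embed′ (crossing-blocks cs)) ⟩
  totalSize (map First.embed′ (chunk-blocks c)) + totalSize (map Rest.embed′ (crossing-blocks cs))
    ≡⟨ cong₂ _+_ (trans (First.totalSize-embed (chunk-blocks c)) (chunk-size c))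
                 (trans (Rest.totalSize-embed (crossing-blocks cs)) (crossing-size cs)) ⟩
  width c * 6 + totalWidth cs * 6
    ≡⟨ sym (ℕₚ.*-distribʳ-+ 6 (width c) (totalWidth cs)) ⟩
  totalWidth (c ∷ cs) * 6 ∎
  where
  open ≡-Reasoning
  open CrossingSplit c cs

WithLeave : ℕ → ℕ → Set
WithLeave n k = Σ[ M ∈ Multipacking n ] leaveSize M ≡ k

-- |E(K_{6+n})| = |E(K_6)| + |E(K_{6,n})| + |E(K_n)|
edges-6+ : ∀ n → length (edges (6 + n)) ≡ (15 + n * 6) + length (edges n)
edges-6+ n rewrite edges-suc (5 + n) | edges-suc (4 + n) | edges-suc (3 + n)
                 | edges-suc (2 + n) | edges-suc (1 + n) | edges-suc n = sum-rows n (length (edges n))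
  where
  sum-rows : ∀ n e → (5 + n) + ((4 + n) + ((3 + n) + ((2 + n) + ((1 + n) + (n + e))))) ≡ (15 + n * 6) + e
  sum-rows = solve-∀

-- The old blocks are
-- shifted to the vertices ≥ 6; new blocks, pairwise disjoint, all of whose edges
-- touch a new vertex, and with 15 + 6n edges together (all of K_6 ∪ K_{6,n}), give
-- a multipacking of K_{6+n} with the same leave.
module Extension {n} (M : Multipacking n) (new : List (Block (6 + n))) (new-disjoint : AllPairs Disjoint new)
                 (new-touching : All (Supported (OneEnd (_< 6))) new) (new-size : totalSize new ≡ 15 + n * 6) where

  module Old = Embedding (λ (u : Fin n) → 6 ↑ʳ u) (↑ʳ-injective 6)

  old : List (Block (6 + n))
  old = map Old.embed′ (blocks M)

  old-outside : All (Supported (BothEnds (6 ≤_))) old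
  old-outside = Old.embed-image (blocks M) λ u v → shifted u , shifted v
    where
    shifted : ∀ (u : Fin n) → 6 ≤ toℕ (6 ↑ʳ u)
    shifted u = subst (6 ≤_) (sym (Fₚ.toℕ-↑ʳ 6 u)) (ℕₚ.m≤m+n 6 (toℕ u))

  extended : Multipacking (6 + n)
  extended = multipacking (new ++ old)
    (AllPairsₚ.++⁺ new-disjoint (Old.embed-disjoint (blocks M) (pairwise-disjoint M))
                   (supported-disjoint new old new-touching old-outside (touching-outside 6)))
    (Anyₚ.++⁺ʳ new (Anyₚ.map⁺ (hasC6 M)))
    (Anyₚ.++⁺ʳ new (Anyₚ.map⁺ (hasC6bar M)))

  same-leave : leaveSize extended ≡ leaveSize M
  same-leave = ℕₚ.+-cancelʳ-≡ (E + totalSize (blocks M)) _ _ (begin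
    leaveSize extended + (E + totalSize (blocks M))
      ≡⟨ cong (leaveSize extended +_) (sym size-new++old) ⟩
    leaveSize extended + totalSize (new ++ old)
      ≡⟨ leave+size≡edges extended ⟩
    length (edges (6 + n))
      ≡⟨ edges-6+ n ⟩
    E + length (edges n)
      ≡⟨ cong (E +_) (sym (leave+size≡edges M)) ⟩
    E + (leaveSize M + totalSize (blocks M))
      ≡⟨ swap E (leaveSize M) (totalSize (blocks M)) ⟩
    leaveSize M + (E + totalSize (blocks M)) ∎)
    where
    open ≡-Reasoning
    E : ℕ
    E = 15 + n * 6
    size-new++old : totalSize (new ++ old) ≡ E + totalSize (blocks M)
    size-new++old = trans (totalSize-++ new old) (cong₂ _+_ new-size (Old.totalSize-embed (blocks M)))
    swap : ∀ x y z → x + (y + z) ≡ y + (x + z)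
    swap = solve-∀

-- K_6 = C₆ ∪ C̄₆ (the complement of the cycle 0-4-2-3-1-5-0 is the prism 012/345)
K6-blocks : List (Block 6)
K6-blocks = copy c6 (# 0 ∷ # 4 ∷ # 2 ∷ # 3 ∷ # 1 ∷ # 5 ∷ [])
          ∷ copy c6bar (# 0 ∷ # 1 ∷ # 2 ∷ # 3 ∷ # 4 ∷ # 5 ∷ []) ∷ []

-- a decomposition of K_6 ∪ K_{6,5} (first six vertices against the last five) of K_11
K6∪K6,5-blocks : List (Block 11)
K6∪K6,5-blocks =
    copy c6bar (# 0 ∷ # 4 ∷ # 6 ∷ # 9 ∷ # 1 ∷ # 3 ∷ [])
  ∷ copy c6bar (# 0 ∷ # 2 ∷ # 8 ∷ # 5 ∷ # 6 ∷ # 1 ∷ [])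
  ∷ copy c6bar (# 2 ∷ # 4 ∷ # 9 ∷ # 3 ∷ # 8 ∷ # 5 ∷ [])
  ∷ copy c6 (# 0 ∷ # 1 ∷ # 2 ∷ # 10 ∷ # 5 ∷ # 7 ∷ [])
  ∷ copy c6 (# 0 ∷ # 3 ∷ # 4 ∷ # 7 ∷ # 1 ∷ # 10 ∷ [])
  ∷ copy c6 (# 2 ∷ # 5 ∷ # 4 ∷ # 10 ∷ # 3 ∷ # 7 ∷ []) ∷ []

-- Step n ↦ n + 6 for n = m, a sum of 4's and 6's: K_6 ∪ K_{6,m}.
step-even : ∀ cs → WithLeave (totalWidth cs) 1 → WithLeave (6 + totalWidth cs) 1
step-even cs (M , leave≡1) = extended , trans same-leave leave≡1
  where
  m : ℕ
  m = totalWidth cs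
  module Front = Embedding (λ (u : Fin 6) → u ↑ˡ m) (↑ˡ-injective m)
  front : List (Block (6 + m))
  front = map Front.embed′ K6-blocks
  front-inside : All (Supported (BothEnds (_< 6))) front
  front-inside = Front.embed-image K6-blocks λ u v → below u , below v
    where
    below : ∀ (u : Fin 6) → toℕ (u ↑ˡ m) < 6
    below u = subst (_< 6) (sym (Fₚ.toℕ-↑ˡ u m)) (Fₚ.toℕ<n u)
  open Extension M (front ++ crossing-blocks cs)
    (AllPairsₚ.++⁺ (Front.embed-disjoint K6-blocks (toWitness {a? = pairwise-disjoint? K6-blocks} _))
                   (crossing-disjoint cs)
                   (supported-disjoint front (crossing-blocks cs) front-inside
                      (supported-weaken proj₂ (crossing-supported cs)) (inside-beyond 6)))
    (Allₚ.++⁺ (supported-weaken (λ b → inj₁ (proj₁ b)) front-inside) (supported-weaken proj₁ (crossing-supported cs)))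
    (trans (totalSize-++ front (crossing-blocks cs)) (cong (15 +_) (crossing-size cs)))

-- Step n ↦ n + 6 for n = 5 + m, m a sum of 4's and 6's: K_6 ∪ K_{6,5} ∪ K_{6,m}.
step-odd : ∀ cs → WithLeave (5 + totalWidth cs) 1 → WithLeave (6 + (5 + totalWidth cs)) 1
step-odd cs (M , leave≡1) = extended , trans same-leave leave≡1
  where
  m : ℕ
  m = totalWidth cs
  module Front = Embedding (λ (u : Fin 11) → u ↑ˡ m) (↑ˡ-injective m)
  module Back  = Embedding (lift 5 {m}) (lift-injective 5)
  Front-edge : ∀ {k} → Fin k → Fin k → Set
  Front-edge u v = OneEnd (_< 6) u v × BothEnds (_< 11) u v
  front back : List (Block (6 + (5 + m)))
  front = map Front.embed′ K6∪K6,5-blocks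
  back  = map Back.embed′ (crossing-blocks cs)
  front-edges : All (Supported Front-edge) front
  front-edges = Front.embed-supported K6∪K6,5-blocks
    (toWitness {a? = All.all? (supported? λ u v → OneEnd? (_<? 6) u v ×-dec ((toℕ u <? 11) ×-dec (toℕ v <? 11)))
                               K6∪K6,5-blocks} _)
    (λ (t , i) → OneEnd-map (_< 6) (_< 6) _ (keep (_< 6)) t , keep (_< 11) (proj₁ i) , keep (_< 11) (proj₂ i))
    where
    keep : ∀ (P : ℕ → Set) {u : Fin 11} → P (toℕ u) → P (toℕ (u ↑ˡ m))
    keep P {u} = subst P (sym (Fₚ.toℕ-↑ˡ u m))
  back-edges : All (Supported (Crossing 11)) back
  back-edges = Back.embed-supported (crossing-blocks cs) (crossing-supported cs)
    (λ (t , b) → OneEnd-map (_< 6) (_< 6) (lift 5) (lift-keeps-low 5) t ,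
                 OneEnd-map (6 ≤_) (11 ≤_) (lift 5) (lift-shifts-high 5 ℕₚ.≤-refl) b)
  size-new : totalSize (front ++ back) ≡ 15 + (5 + m) * 6
  size-new = begin
    totalSize (front ++ back) ≡⟨ totalSize-++ front back ⟩
    45 + totalSize back       ≡⟨ cong (45 +_) (trans (Back.totalSize-embed (crossing-blocks cs)) (crossing-size cs)) ⟩
    45 + m * 6                ≡⟨ regroup m ⟩
    15 + (5 + m) * 6          ∎
    where
    open ≡-Reasoning
    regroup : ∀ m → 45 + m * 6 ≡ 15 + (5 + m) * 6
    regroup = solve-∀
  open Extension M (front ++ back)
    (AllPairsₚ.++⁺ (Front.embed-disjoint K6∪K6,5-blocks (toWitness {a? = pairwise-disjoint? K6∪K6,5-blocks} _))
                   (Back.embed-disjoint (crossing-blocks cs) (crossing-disjoint cs))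
                   (supported-disjoint front back (supported-weaken proj₂ front-edges)
                      (supported-weaken proj₂ back-edges) (inside-beyond 11)))
    (Allₚ.++⁺ (supported-weaken proj₁ front-edges) (supported-weaken proj₁ back-edges))
    size-new

K8-blocks : List (Block 8)
K8-blocks = copy c6bar (# 0 ∷ # 2 ∷ # 7 ∷ # 1 ∷ # 6 ∷ # 5 ∷ [])
          ∷ copy c6 (# 0 ∷ # 3 ∷ # 5 ∷ # 4 ∷ # 7 ∷ # 6 ∷ [])
          ∷ copy c6 (# 0 ∷ # 4 ∷ # 1 ∷ # 3 ∷ # 2 ∷ # 5 ∷ [])
          ∷ copy c6 (# 1 ∷ # 2 ∷ # 4 ∷ # 6 ∷ # 3 ∷ # 7 ∷ []) ∷ []

K11-blocks : List (Block 11)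
K11-blocks = copy c6bar (# 9 ∷ # 0 ∷ # 1 ∷ # 2 ∷ # 10 ∷ # 3 ∷ [])
           ∷ copy c6bar (# 0 ∷ # 2 ∷ # 4 ∷ # 5 ∷ # 1 ∷ # 10 ∷ [])
           ∷ copy c6bar (# 3 ∷ # 6 ∷ # 7 ∷ # 9 ∷ # 4 ∷ # 8 ∷ [])
           ∷ copy c6bar (# 5 ∷ # 7 ∷ # 9 ∷ # 8 ∷ # 10 ∷ # 6 ∷ [])
           ∷ copy c6 (# 0 ∷ # 3 ∷ # 4 ∷ # 7 ∷ # 1 ∷ # 6 ∷ [])
           ∷ copy c6 (# 0 ∷ # 7 ∷ # 2 ∷ # 5 ∷ # 3 ∷ # 8 ∷ [])
           ∷ copy c6 (# 1 ∷ # 4 ∷ # 5 ∷ # 6 ∷ # 2 ∷ # 8 ∷ []) ∷ []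

K8 : WithLeave 8 1
K8 = multipacking K8-blocks (toWitness {a? = pairwise-disjoint? K8-blocks} _) (there (here refl)) (here refl) , refl

K11 : WithLeave 11 1
K11 = multipacking K11-blocks (toWitness {a? = pairwise-disjoint? K11-blocks} _)
                   (there (there (there (there (here refl))))) (here refl) , refl

sixes : ℕ → List Chunk
sixes zero    = []
sixes (suc k) = six ∷ sixes k

totalWidth-sixes : ∀ k → totalWidth (sixes k) ≡ k * 6
totalWidth-sixes zero    = refl
totalWidth-sixes (suc k) = cong (6 +_) (totalWidth-sixes k)

-- K_{8+6k}: from K_8 by steps with K_{6, 4+4+6k}
leave-one-8+6k : ∀ k → WithLeave (8 + k * 6) 1
leave-one-8+6k zero = K8
leave-one-8+6k (suc k) with step-even (four ∷ four ∷ sixes k)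
... | step rewrite totalWidth-sixes k = step (leave-one-8+6k k)

-- K_{11+6k}: from K_11 by steps with K_6 ∪ K_{6,5} ∪ K_{6,6+6k}
leave-one-11+6k : ∀ k → WithLeave (11 + k * 6) 1
leave-one-11+6k zero = K11
leave-one-11+6k (suc k) with step-odd (sixes (suc k))
... | step rewrite totalWidth-sixes k = step (leave-one-11+6k k)

Split : ℕ → Set
Split n = (∃ λ k → n ≡ 8 + k * 6) ⊎ (∃ λ k → n ≡ 11 + k * 6)

split-2+3q : ∀ q → 8 ≤ 2 + q * 3 → Split (2 + q * 3)
split-2+3q 0 (s≤s (s≤s ()))
split-2+3q 1 (s≤s (s≤s (s≤s (s≤s (s≤s ())))))
split-2+3q 2 _ = inj₁ (0 , refl)
split-2+3q 3 _ = inj₂ (0 , refl)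
split-2+3q (suc (suc (suc (suc q)))) _ with split-2+3q (suc (suc q)) (ℕₚ.m≤m+n 8 (q * 3))
... | inj₁ (k , e) = inj₁ (suc k , cong (6 +_) e)
... | inj₂ (k , e) = inj₂ (suc k , cong (6 +_) e)

n≡2+3q : ∀ n → n % 3 ≡ 2 → n ≡ 2 + (n / 3) * 3
n≡2+3q n n%3≡2 = trans (m≡m%n+[m/n]*n n 3) (cong (_+ (n / 3) * 3) n%3≡2)

residue-cases : ∀ n → n % 3 ≡ 2 → 8 ≤ n → Split n
residue-cases n n%3≡2 8≤n =
  subst Split (sym (n≡2+3q n n%3≡2)) (split-2+3q (n / 3) (subst (8 ≤_) (n≡2+3q n n%3≡2) 8≤n))

leave-one : ∀ n → n % 3 ≡ 2 → 8 ≤ n → WithLeave n 1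
leave-one n n%3≡2 8≤n with residue-cases n n%3≡2 8≤n
... | inj₁ (k , refl) = leave-one-8+6k k
... | inj₂ (k , refl) = leave-one-11+6k k

_≟ᴷ_ : DecidableEquality Kind
c6    ≟ᴷ c6    = yes refl
c6    ≟ᴷ c6bar = no λ ()
c6bar ≟ᴷ c6    = no λ ()
c6bar ≟ᴷ c6bar = yes refl

is : ∀ {n} → Kind → Block n → Bool
is k b = does (kind b ≟ᴷ k)

is-sound : ∀ {n} k (b : Block n) → is k b ≡ true → kind b ≡ k
is-sound k b h with kind b ≟ᴷ k
... | yes e = e

is-complete : ∀ {n} k (b : Block n) → kind b ≡ k → is k b ≡ true
is-complete k b refl with kind b ≟ᴷ kind b
... | yes _ = refl
... | no ≢  = ⊥-elim (≢ refl)

count-kind-pos : ∀ {n} k (bs : List (Block n)) → Any (λ b → kind b ≡ k) bs → 1 ≤ count (is k) bs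
count-kind-pos k bs has with find has
... | b , m , e = count-pos (is k) bs b m (is-complete k b e)

totalSize≡counts : ∀ {n} (bs : List (Block n)) → totalSize bs ≡ count (is c6) bs * 6 + count (is c6bar) bs * 9
totalSize≡counts [] = refl
totalSize≡counts (b ∷ bs) with kind b
... | c6    = cong (6 +_) (totalSize≡counts bs)
... | c6bar = trans (cong (9 +_) (totalSize≡counts bs)) (shift _ _)
  where
  shift : ∀ x y → 9 + (x + y) ≡ x + (9 + y)
  shift = solve-∀

edge-count : ∀ {n} (M : Multipacking n) →
             count (is c6) (blocks M) * 6 + count (is c6bar) (blocks M) * 9 + leaveSize M ≡ length (edges n)
edge-count M = trans (cong (_+ leaveSize M) (sym (totalSize≡counts (blocks M))))
                     (trans (ℕₚ.+-comm (totalSize (blocks M)) (leaveSize M)) (leave+size≡edges M))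

edges-2+3q : ∀ q → ∃ λ g → length (edges (2 + q * 3)) ≡ 1 + g * 3
edges-2+3q zero = 0 , refl
edges-2+3q (suc q) with edges-2+3q q
... | g , e = 3 + q * 3 + g , lemma
  where
  rows : ∀ q g → (4 + q * 3) + ((3 + q * 3) + ((2 + q * 3) + (1 + g * 3))) ≡ 1 + (3 + q * 3 + g) * 3
  rows = solve-∀
  lemma : length (edges (2 + suc q * 3)) ≡ 1 + (3 + q * 3 + g) * 3
  lemma rewrite edges-suc (4 + q * 3) | edges-suc (3 + q * 3) | edges-suc (2 + q * 3) | e = rows q g

-- Lower bound for n ≡ 2 (mod 3): all block sizes are multiples of 3 but
-- |E(K_n)| is not, so the leave is non-empty.
leave-nonempty : ∀ n → n % 3 ≡ 2 → (M : Multipacking n) → 1 ≤ leaveSize M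
leave-nonempty n n%3≡2 M with leaveSize M in leave≡ | edges-2+3q (n / 3)
... | suc _ | _     = s≤s z≤n
... | zero  | g , e = ⊥-elim (0≢1 (begin
  0                                  ≡⟨ sym (m*n%n≡0 (a * 2 + b * 3) 3) ⟩
  ((a * 2 + b * 3) * 3) % 3          ≡⟨ cong (_% 3) sizes≡edges ⟩
  (1 + g * 3) % 3                    ≡⟨ [m+kn]%n≡m%n 1 g 3 ⟩
  1                                  ∎))
  where
  open ≡-Reasoning
  a b : ℕ
  a = count (is c6) (blocks M)
  b = count (is c6bar) (blocks M)
  0≢1 : 0 ≢ 1
  0≢1 ()
  sizes≡edges : (a * 2 + b * 3) * 3 ≡ 1 + g * 3
  sizes≡edges = trans (regroup a b) (trans (sym (ℕₚ.+-identityʳ _)) (trans (cong (a * 6 + b * 9 +_) (sym leave≡))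
                  (trans (edge-count M) (trans (cong (λ m → length (edges m)) (n≡2+3q n n%3≡2)) e))))
    where
    regroup : ∀ a b → (a * 2 + b * 3) * 3 ≡ a * 6 + b * 9
    regroup = solve-∀

-- Deciding claims about the non-negative solutions of x·p + y·q + r = t by
-- checking the finitely many candidates x, y ≤ t.
module LinearSolutions (p q t : ℕ) .{{_ : NonZero p}} .{{_ : NonZero q}}
                       {C : ℕ → ℕ → ℕ → Set} (C? : ∀ x y r → Dec (C x y r)) where

  check : Dec (∀ (x y : Fin (suc t)) → toℕ x * p + toℕ y * q ≤ t → C (toℕ x) (toℕ y) (t ∸ (toℕ x * p + toℕ y * q)))
  check = Fₚ.all? λ x → Fₚ.all? λ y → (toℕ x * p + toℕ y * q ≤? t) →-dec C? (toℕ x) (toℕ y) _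

  solutions : {True check} → ∀ x y r → x * p + y * q + r ≡ t → C x y r
  solutions {ok} x y r eq =
    subst (C x y) r≡ (subst₂ (λ a b → C a b (t ∸ (a * p + b * q))) (Fₚ.toℕ-fromℕ< x<) (Fₚ.toℕ-fromℕ< y<)
      (toWitness ok (F.fromℕ< x<) (F.fromℕ< y<)
        (subst₂ (λ a b → a * p + b * q ≤ t) (sym (Fₚ.toℕ-fromℕ< x<)) (sym (Fₚ.toℕ-fromℕ< y<)) xy≤t)))
    where
    xy≤t : x * p + y * q ≤ t
    xy≤t = subst (x * p + y * q ≤_) eq (ℕₚ.m≤m+n _ r)
    x< : x < suc t
    x< = s≤s (ℕₚ.≤-trans (ℕₚ.m≤m*n x p) (ℕₚ.≤-trans (ℕₚ.m≤m+n _ _) xy≤t))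
    y< : y < suc t
    y< = s≤s (ℕₚ.≤-trans (ℕₚ.m≤m*n y q) (ℕₚ.≤-trans (ℕₚ.m≤n+m _ _) xy≤t))
    r≡ : t ∸ (x * p + y * q) ≡ r
    r≡ = trans (cong (_∸ (x * p + y * q)) (sym eq)) (ℕₚ.m+n∸m≡n (x * p + y * q) r)

adjacent : Kind → Fin 6 → Fin 6 → Bool
adjacent k x y = member (pattern-edges k) (x , y) ∨ member (pattern-edges k) (y , x)
  where open Membership _≟²_

neighbours : Kind → Fin 6 → List (Fin 6)
neighbours k x = filter (λ y → T? (adjacent k x y)) (allFin 6)

degree : Kind → ℕ
degree c6    = 2
degree c6bar = 3

neighbours-unique : ∀ k x → Unique (neighbours k x)
neighbours-unique k x = Uniqueₚ.filter⁺ (λ y → T? (adjacent k x y)) (Uniqueₚ.allFin⁺ 6)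

∈-neighbours : ∀ k x {y} → adjacent k x y ≡ true → y ∈ neighbours k x
∈-neighbours k x {y} h = ∈-filter⁺ (λ y → T? (adjacent k x y)) (∈-allFin y) (subst T (sym h) tt)

neighbours-adjacent : ∀ k x {y} → y ∈ neighbours k x → adjacent k x y ≡ true
neighbours-adjacent k x {y} m with adjacent k x y | proj₂ (∈-filter⁻ (λ y → T? (adjacent k x y)) {xs = allFin 6} m)
... | true | _ = refl

length-neighbours : ∀ k x → length (neighbours k x) ≡ degree k
length-neighbours k = toWitness {a? = Fₚ.all? λ x → length (neighbours k x) ≟ degree k} (regular k)
  where
  regular : ∀ k → True (Fₚ.all? λ x → length (neighbours k x) ≟ degree k)
  regular c6    = _
  regular c6bar = _

adjacent-irrefl : ∀ k x → adjacent k x x ≡ false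
adjacent-irrefl k = toWitness {a? = Fₚ.all? λ x → adjacent k x x Boolₚ.≟ false} (loopless? k)
  where
  loopless? : ∀ k → True (Fₚ.all? λ x → adjacent k x x Boolₚ.≟ false)
  loopless? c6    = _
  loopless? c6bar = _

covers-adjacent : ∀ {n} (b : Block n) {x y u} → place b x ≡ u → adjacent (kind b) x y ≡ true →
                  covers b u (place b y) ≡ true
covers-adjacent b {x} {y} {u} px h with member (pattern-edges (kind b)) (x , y) in xy
  where open Membership _≟²_
... | true  = covers-complete b u (place b y) (x , y) (member-sound _ _ xy) (inj₁ (px , refl))
  where open Membership _≟²_
... | false = covers-complete b u (place b y) (y , x) (member-sound _ _ h) (inj₂ (refl , px))
  where open Membership _≟²_

adjacent-covers : ∀ {n} (b : Block n) {x u v} → place b x ≡ u → covers b u v ≡ true →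
                  Σ[ y ∈ Fin 6 ] (adjacent (kind b) x y ≡ true × place b y ≡ v)
adjacent-covers b {x} px h with covers-sound b _ _ h
... | (x′ , y′) , m , inj₁ (p , q) with inj b (trans p (sym px))
...   | refl = y′ , edge , q
  where
  edge : adjacent (kind b) x′ y′ ≡ true
  edge rewrite Membership.member-complete _≟²_ (pattern-edges (kind b)) (x′ , y′) m = refl
adjacent-covers b {x} px h | (x′ , y′) , m , inj₂ (p , q) with inj b (trans q (sym px))
...   | refl = x′ , edge , p
  where
  edge : adjacent (kind b) y′ x′ ≡ true
  edge rewrite Membership.member-complete _≟²_ (pattern-edges (kind b)) (x′ , y′) m = Boolₚ.∨-zeroʳ _

locate : ∀ {n} (b : Block n) w → Dec (∃ λ x → place b x ≡ w)
locate b w = Fₚ.any? (λ x → place b x F.≟ w)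

occurs : ∀ {n} → Block n → Fin n → Bool
occurs b w = does (locate b w)

occurs-complete : ∀ {n} (b : Block n) {x w} → place b x ≡ w → occurs b w ≡ true
occurs-complete b {x} {w} px = dec-true (locate b w) (x , px)

witness : ∀ {n} (b : Block n) {w} → Dec (∃ λ x → place b x ≡ w) → Fin 6
witness b (yes (x , _)) = x
witness b (no _)        = zero

position : ∀ {n} → Block n → Fin n → Fin 6
position b w = witness b (locate b w)

position-spec : ∀ {n} (b : Block n) w → occurs b w ≡ true → place b (position b w) ≡ w
position-spec b w = spec (locate b w)
  where
  spec : (d : Dec (∃ λ x → place b x ≡ w)) → does d ≡ true →
         place b (witness b d) ≡ w
  spec (yes (_ , px)) _ = px
blockDegree : ∀ {n} → Block n → Fin n → ℕ
blockDegree b w = if occurs b w then degree (kind b) else 0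

count-covers : ∀ {n} (b : Block n) w → count (covers b w) (allFin n) ≡ blockDegree b w
count-covers {n} b w with occurs b w in occ
... | true = begin
  count (covers b w) (allFin n)  ≡⟨ count-cong _ _ (allFin n) (λ v _ → bool-ext (to v) (from v)) ⟩
  count (member N) (allFin n)    ≡⟨ count-member (allFin n) N (Uniqueₚ.allFin⁺ n) N-unique (λ v _ → ∈-allFin v) ⟩
  length N                       ≡⟨ Lₚ.length-map (place b) (neighbours (kind b) x) ⟩
  length (neighbours (kind b) x) ≡⟨ length-neighbours (kind b) x ⟩
  degree (kind b)                ∎
  where
  open ≡-Reasoning
  open Membership F._≟_
  x : Fin 6
  x = position b w
  px : place b x ≡ w
  px = position-spec b w occ
  N : List (Fin n)
  N = map (place b) (neighbours (kind b) x)
  N-unique : Unique N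
  N-unique = Uniqueₚ.map⁺ (inj b) (neighbours-unique (kind b) x)
  to : ∀ v → covers b w v ≡ true → member N v ≡ true
  to v h with adjacent-covers b px h
  ... | y , a , refl = member-complete N (place b y) (∈-map⁺ (place b) (∈-neighbours (kind b) x a))
  from : ∀ v → member N v ≡ true → covers b w v ≡ true
  from v h with ∈-map⁻ (place b) (member-sound N v h)
  ... | y , m , refl = covers-adjacent b px (neighbours-adjacent (kind b) x m)
... | false = count-none _ (allFin n) absent
  where
  absent : ∀ v → v ∈ allFin n → covers b w v ≡ false
  absent v _ with covers b w v in h
  ... | false = refl
  ... | true with covers-sound b w v h
  ...   | _ , _ , inj₁ (p , _) with trans (sym occ) (occurs-complete b p)
  ...     | ()
  absent v _ | true | _ , _ , inj₂ (_ , q) with trans (sym occ) (occurs-complete b q)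
  ...     | ()

coveredBy-sym : ∀ {n} (bs : List (Block n)) u v → coveredBy bs u v ≡ coveredBy bs v u
coveredBy-sym [] u v = refl
coveredBy-sym (b ∷ bs) u v = cong₂ _∨_ (covers-sym b u v) (coveredBy-sym bs u v)

coveredBy-irrefl : ∀ {n} (bs : List (Block n)) u → coveredBy bs u u ≡ false
coveredBy-irrefl [] u = refl
coveredBy-irrefl (b ∷ bs) u rewrite covers-irrefl b u = coveredBy-irrefl bs u

empty-leave-covers< : ∀ {n} (M : Multipacking n) → leaveSize M ≡ 0 → ∀ u v → u F.< v → coveredBy (blocks M) u v ≡ true
empty-leave-covers< {n} M leave≡0 u v u<v =
  not-false (count≡0 _ (edges n) (trans (sym (leaveSize≡count M)) leave≡0) (u , v) (∈-edges⁺ u v u<v))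
  where
  not-false : ∀ {b} → not b ≡ false → b ≡ true
  not-false {true} _ = refl

empty-leave-covers : ∀ {n} (M : Multipacking n) → leaveSize M ≡ 0 → ∀ u v → u ≢ v → coveredBy (blocks M) u v ≡ true
empty-leave-covers M leave≡0 u v u≢v with Fₚ.<-cmp u v
... | tri< u<v _ _ = empty-leave-covers< M leave≡0 u v u<v
... | tri≈ _ u≡v _ = ⊥-elim (u≢v u≡v)
... | tri> _ _ v<u = trans (coveredBy-sym (blocks M) u v) (empty-leave-covers< M leave≡0 v u v<u)

count-coveredBy-at : ∀ {n} (bs : List (Block n)) w → AllPairs Disjoint bs →
                     count (coveredBy bs w) (allFin n) ≡ sum (map (λ b → blockDegree b w) bs)
count-coveredBy-at {n} bs w ap = begin
  count (coveredBy bs w) (allFin n)                              ≡⟨ count-map (coveredEdge bs) (w ,_) (allFin n) ⟨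
  count (coveredEdge bs) (map (w ,_) (allFin n))                 ≡⟨ count-coveredBy bs (map (w ,_) (allFin n)) ap ⟩
  sum (map (λ b → count (coversEdge b) (map (w ,_) (allFin n))) bs)
    ≡⟨ cong sum (Lₚ.map-cong (λ b → trans (count-map (coversEdge b) (w ,_) (allFin n)) (count-covers b w)) bs) ⟩
  sum (map (λ b → blockDegree b w) bs)                          ∎
  where open ≡-Reasoning

copiesAt : ∀ {n} → Kind → List (Block n) → Fin n → ℕ
copiesAt k bs w = count (λ b → is k b ∧ occurs b w) bs

sum-blockDegree : ∀ {n} (bs : List (Block n)) w →
                  sum (map (λ b → blockDegree b w) bs) ≡ copiesAt c6 bs w * 2 + copiesAt c6bar bs w * 3
sum-blockDegree [] w = refl
sum-blockDegree (b ∷ bs) w with kind b | occurs b w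
... | c6    | true  = cong (2 +_) (sum-blockDegree bs w)
... | c6bar | true  = trans (cong (3 +_) (sum-blockDegree bs w)) (shift _ _)
  where
  shift : ∀ x y → 3 + (x + y) ≡ x + (3 + y)
  shift = solve-∀
... | c6    | false = sum-blockDegree bs w
... | c6bar | false = sum-blockDegree bs w

degree-identity : ∀ {n} (M : Multipacking n) → leaveSize M ≡ 0 → ∀ w →
                  copiesAt c6 (blocks M) w * 2 + copiesAt c6bar (blocks M) w * 3 + 1 ≡ n
degree-identity {n} M leave≡0 w = begin
  copiesAt c6 (blocks M) w * 2 + copiesAt c6bar (blocks M) w * 3 + 1
    ≡⟨ cong (_+ 1) (sym (trans (count-coveredBy-at (blocks M) w (pairwise-disjoint M)) (sum-blockDegree (blocks M) w))) ⟩
  count (coveredBy (blocks M) w) (allFin n) + 1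
    ≡⟨ cong₂ _+_ (count-cong _ _ (allFin n) (λ v _ → covered-iff-other v))
                 (sym (count-occurrence (allFin n) (Uniqueₚ.allFin⁺ n) w (∈-allFin w))) ⟩
  count (λ v → not (does (v F.≟ w))) (allFin n) + count (λ v → does (v F.≟ w)) (allFin n)
    ≡⟨ count-not (λ v → does (v F.≟ w)) (allFin n) ⟩
  length (allFin n)
    ≡⟨ Lₚ.length-tabulate (λ v → v) ⟩
  n ∎
  where
  open ≡-Reasoning
  open Membership F._≟_
  covered-iff-other : ∀ v → coveredBy (blocks M) w v ≡ not (does (v F.≟ w))
  covered-iff-other v with v F.≟ w
  ... | yes refl = coveredBy-irrefl (blocks M) v
  ... | no v≢w   = empty-leave-covers M leave≡0 w v (λ e → v≢w (sym e))

_⊆ᵛ_ : ∀ {n} → Block n → Block n → Set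
B ⊆ᵛ H = ∀ y → occurs H (place B y) ≡ true

free : Kind → Fin 6 → Fin 6 → Bool
free k x z = not (does (z F.≟ x)) ∧ not (adjacent k x z)

count-free : ∀ k x → count (free k x) (allFin 6) ≡ 5 ∸ degree k
count-free k = toWitness {a? = Fₚ.all? λ x → count (free k x) (allFin 6) ≟ 5 ∸ degree k} (check k)
  where
  check : ∀ k → True (Fₚ.all? λ x → count (free k x) (allFin 6) ≟ 5 ∸ degree k)
  check c6    = _
  check c6bar = _

-- The neighbours of B's vertex at position x, read as positions of the host H.
pulled : ∀ {n} (H B : Block n) → Fin 6 → List (Fin 6)
pulled H B x = map (λ y → position H (place B y)) (neighbours (kind B) x)

module Pulled {n} (H B : Block n) (B⊆H : B ⊆ᵛ H) (x : Fin 6) where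

  on-host : ∀ y → place H (position H (place B y)) ≡ place B y
  on-host y = position-spec H (place B y) (B⊆H y)

  pulled-length : length (pulled H B x) ≡ degree (kind B)
  pulled-length = trans (Lₚ.length-map _ (neighbours (kind B) x)) (length-neighbours (kind B) x)

  pulled-unique : Unique (pulled H B x)
  pulled-unique = Uniqueₚ.map⁺ (λ e → inj B (trans (sym (on-host _)) (trans (cong (place H) e) (on-host _))))
                               (neighbours-unique (kind B) x)

  pulled-neighbour : ∀ {z} → z ∈ pulled H B x → Σ[ y ∈ Fin 6 ] (z ≡ position H (place B y) × adjacent (kind B) x y ≡ true)
  pulled-neighbour m with ∈-map⁻ _ m
  ... | y , my , refl = y , refl , neighbours-adjacent (kind B) x my

  pulled-free : ∀ h → place B x ≡ place H h → Disjoint H B → ∀ z → z ∈ pulled H B x → free (kind H) h z ≡ true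
  pulled-free h x≡h H∩B z m with pulled-neighbour m
  ... | y , refl , x~y with position H (place B y) F.≟ h | adjacent (kind H) h (position H (place B y)) in h~z
  ...   | no _    | false = refl
  ...   | yes z≡h | _     =
    ⊥-elim (true≢false (trans (sym x~y) (subst (λ t → adjacent (kind B) x t ≡ false) x≡y (adjacent-irrefl (kind B) x))))
    where
    x≡y : x ≡ y
    x≡y = inj B (trans x≡h (trans (cong (place H) (sym z≡h)) (on-host y)))
  ...   | no _    | true  = ⊥-elim (true≢false (trans (sym (covers-adjacent B refl x~y)) (H∩B _ _ H-edge)))
    where
    H-edge : covers H (place B x) (place B y) ≡ true
    H-edge = subst₂ (λ a c → covers H a c ≡ true) (sym x≡h) (on-host y) (covers-adjacent H refl h~z)

pulled-apart : ∀ {n} (H B B′ : Block n) (B⊆H : B ⊆ᵛ H) (B′⊆H : B′ ⊆ᵛ H) x x′ →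
               place B x ≡ place B′ x′ → Disjoint B B′ →
               ∀ {z} → z ∈ pulled H B x → z ∈ pulled H B′ x′ → ⊥
pulled-apart H B B′ B⊆H B′⊆H x x′ x≡x′ B∩B′ m m′
  with Pulled.pulled-neighbour H B B⊆H x m | Pulled.pulled-neighbour H B′ B′⊆H x′ m′
... | y , refl , x~y | y′ , z≡ , x′~y′ = true≢false (trans (sym B′-edge) (B∩B′ _ _ (covers-adjacent B refl x~y)))
  where
  y≡y′ : place B y ≡ place B′ y′
  y≡y′ = trans (sym (Pulled.on-host H B B⊆H x y)) (trans (cong (place H) z≡) (Pulled.on-host H B′ B′⊆H x′ y′))
  B′-edge : covers B′ (place B x) (place B y) ≡ true
  B′-edge = subst₂ (λ a c → covers B′ a c ≡ true) (sym x≡x′) (sym y≡y′) (covers-adjacent B′ refl x′~y′)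

-- Blocks inside a host H, disjoint from H and from
-- each other, all passing through a vertex w of H, use disjoint sets of free
-- positions around w in H; there are only 5 - deg(H) of them.
module LocalPigeonhole {n} (H : Block n) (w : Fin n) where

  open Membership (F._≟_ {6}) using (length≤count)

  position-at : ∀ (B : Block n) → B ⊆ᵛ H → occurs B w ≡ true → place B (position B w) ≡ place H (position H w)
  position-at B B⊆H occ = trans w≡ (sym (position-spec H w (subst (λ v → occurs H v ≡ true) w≡ (B⊆H (position B w)))))
    where
    w≡ : place B (position B w) ≡ w
    w≡ = position-spec B w occ

  free-bound : (Z : List (Fin 6)) → Unique Z → (∀ z → z ∈ Z → free (kind H) (position H w) z ≡ true) →
               length Z ≤ 5 ∸ degree (kind H)
  free-bound Z uZ h = subst (length Z ≤_) (count-free (kind H) (position H w))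
    (length≤count (allFin 6) Z _ (Uniqueₚ.allFin⁺ 6) uZ (λ z _ → ∈-allFin z) h)

  inside-one : ∀ B → Disjoint H B → B ⊆ᵛ H → occurs B w ≡ true → degree (kind B) ≤ 5 ∸ degree (kind H)
  inside-one B H∩B B⊆H occ = subst (_≤ 5 ∸ degree (kind H)) pulled-length
    (free-bound (pulled H B x) pulled-unique (pulled-free (position H w) (position-at B B⊆H occ) H∩B))
    where
    x : Fin 6
    x = position B w
    open Pulled H B B⊆H x

  inside-two : ∀ B B′ → Disjoint H B → Disjoint H B′ → Disjoint B B′ → B ⊆ᵛ H → B′ ⊆ᵛ H →
               occurs B w ≡ true → occurs B′ w ≡ true → degree (kind B) + degree (kind B′) ≤ 5 ∸ degree (kind H)
  inside-two B B′ H∩B H∩B′ B∩B′ B⊆H B′⊆H occ occ′ =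
    subst (_≤ 5 ∸ degree (kind H)) (trans (Lₚ.length-++ Z) (cong₂ _+_ P.pulled-length P′.pulled-length))
      (free-bound (Z ++ Z′)
        (Uniqueₚ.++⁺ P.pulled-unique P′.pulled-unique
          (λ (m , m′) → pulled-apart H B B′ B⊆H B′⊆H x x′ same-vertex B∩B′ m m′))
        all-free)
    where
    x x′ : Fin 6
    x  = position B w
    x′ = position B′ w
    same-vertex : place B x ≡ place B′ x′
    same-vertex = trans (position-at B B⊆H occ) (sym (position-at B′ B′⊆H occ′))
    module P  = Pulled H B B⊆H x
    module P′ = Pulled H B′ B′⊆H x′
    Z Z′ : List (Fin 6)
    Z  = pulled H B x
    Z′ = pulled H B′ x′
    all-free : ∀ z → z ∈ Z ++ Z′ → free (kind H) (position H w) z ≡ true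
    all-free z m with ∈-++⁻ Z m
    ... | inj₁ m  = P.pulled-free (position H w) (position-at B B⊆H occ) H∩B z m
    ... | inj₂ m′ = P′.pulled-free (position H w) (position-at B′ B′⊆H occ′) H∩B′ z m′

module Saturated {n} (bs : List (Block n)) (k : Kind)
                 (saturated : ∀ w → 1 ≤ copiesAt k bs w → copiesAt k bs w ≡ count (is k) bs) where

  through-all : ∀ w {B C} → B ∈ bs → is k B ≡ true → occurs B w ≡ true → C ∈ bs → is k C ≡ true → occurs C w ≡ true
  through-all w {B} {C} mB kB occ mC kC =
    count-∧-full (is k) (λ b → occurs b w) bs (saturated w (count-pos _ bs B mB (∧-intro kB occ))) C mC kC

  same-vertices : ∀ {B C} → B ∈ bs → is k B ≡ true → C ∈ bs → is k C ≡ true → B ⊆ᵛ C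
  same-vertices {B} mB kB mC kC y = through-all (place B y) mB kB (occurs-complete B refl) mC kC

kind-of : ∀ {n} k (B : Block n) → is k B ≡ true → degree (kind B) ≡ degree k
kind-of k B h = cong degree (is-sound k B h)

module Copies {n} (M : Multipacking n) where
  bs : List (Block n)
  bs = blocks M
  #C₆ #C̄₆ : ℕ
  #C₆  = count (is c6) bs
  #C̄₆ = count (is c6bar) bs

  #C₆≥1 : 1 ≤ #C₆
  #C₆≥1 = count-kind-pos c6 bs (hasC6 M)

  #C̄₆≥1 : 1 ≤ #C̄₆
  #C̄₆≥1 = count-kind-pos c6bar bs (hasC6bar M)

  some-C̄₆ : Σ[ B ∈ Block n ] (B ∈ bs × is c6bar B ≡ true)
  some-C̄₆ with find (hasC6bar M)
  ... | B , m , e = B , m , is-complete c6bar B e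

-- K_7: with a leave of fewer than 6 edges the only possibility is one C̄₆ and two
-- C₆'s covering all 21 edges; but then a vertex of the C̄₆ would have degree
-- 6 = 2x + 3, which is odd.
sizes-K7 : ∀ a b L → a * 6 + b * 9 + L ≡ 21 → 1 ≤ a → 1 ≤ b → L < 6 → L ≡ 0 × b ≡ 1
sizes-K7 = LinearSolutions.solutions 6 9 21
  (λ a b L → (1 ≤? a) →-dec (1 ≤? b) →-dec (L <? 6) →-dec ((L ≟ 0) ×-dec (b ≟ 1)))

degrees-K7 : ∀ x y r → x * 2 + y * 3 + r ≡ 7 → r ≡ 1 → y ≢ 1
degrees-K7 = LinearSolutions.solutions 2 3 7 (λ x y r → (r ≟ 1) →-dec ¬? (y ≟ 1))

lower-bound-K7 : (M : Multipacking 7) → 6 ≤ leaveSize M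
lower-bound-K7 M = ℕₚ.≮⇒≥ λ L<6 →
  let L≡0 , b≡1 = sizes-K7 _ _ _ (edge-count M) #C₆≥1 #C̄₆≥1 L<6
      B , mB , kB = some-C̄₆
      w : Fin 7
      w = place B zero
      one-C̄₆-at-w : copiesAt c6bar bs w ≡ 1
      one-C̄₆-at-w = ℕₚ.≤-antisym (subst (copiesAt c6bar bs w ≤_) b≡1 (count-∧≤ (is c6bar) (λ b → occurs b w) bs))
                                   (count-pos _ bs B mB (∧-intro kB (occurs-complete B refl)))
  in degrees-K7 (copiesAt c6 bs w) _ _ (degree-identity M L≡0 w) refl one-C̄₆-at-w
  where open Copies M

-- K_9: with a leave of fewer than 3 edges, all 36 edges are covered by three C₆'s
-- and two C̄₆'s.  A vertex has degree 8 = 2x + 3y, so it lies on none or both of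
-- the C̄₆'s: both C̄₆'s have the same six vertices, impossible by the local
-- pigeonhole principle (3 neighbours but only 5 - 3 free positions).
sizes-K9 : ∀ a b L → a * 6 + b * 9 + L ≡ 36 → 1 ≤ a → 1 ≤ b → L < 3 → L ≡ 0 × b ≡ 2
sizes-K9 = LinearSolutions.solutions 6 9 36
  (λ a b L → (1 ≤? a) →-dec (1 ≤? b) →-dec (L <? 3) →-dec ((L ≟ 0) ×-dec (b ≟ 2)))

degrees-K9 : ∀ x y r → x * 2 + y * 3 + r ≡ 9 → r ≡ 1 → 1 ≤ y → y ≤ 2 → y ≡ 2
degrees-K9 = LinearSolutions.solutions 2 3 9 (λ x y r → (r ≟ 1) →-dec (1 ≤? y) →-dec (y ≤? 2) →-dec (y ≟ 2))

lower-bound-K9 : (M : Multipacking 9) → 3 ≤ leaveSize M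
lower-bound-K9 M = ℕₚ.≮⇒≥ λ L<3 → let L≡0 , b≡2 = sizes-K9 _ _ _ (edge-count M) #C₆≥1 #C̄₆≥1 L<3 in
  two-C̄₆-impossible L≡0 b≡2 (pair-of (is c6bar) (pairwise-disjoint M) (ℕₚ.≤-reflexive (sym b≡2)))
  where
  open Copies M
  two-C̄₆-impossible : leaveSize M ≡ 0 → #C̄₆ ≡ 2 →
    Σ[ H ∈ Block 9 ] Σ[ B ∈ Block 9 ] (H ∈ bs × B ∈ bs × is c6bar H ≡ true × is c6bar B ≡ true × Disjoint H B) → ⊥
  two-C̄₆-impossible L≡0 b≡2 (H , B , mH , mB , kH , kB , H∩B) =
    3≰2 (subst₂ (λ d e → d ≤ 5 ∸ e) (kind-of c6bar B kB) (kind-of c6bar H kH)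
      (LocalPigeonhole.inside-one H (place B zero) B H∩B (same-vertices mB kB mH kH) (occurs-complete B refl)))
    where
    saturated : ∀ w → 1 ≤ copiesAt c6bar bs w → copiesAt c6bar bs w ≡ #C̄₆
    saturated w pos = trans (degrees-K9 (copiesAt c6 bs w) _ _ (degree-identity M L≡0 w) refl pos
      (subst (copiesAt c6bar bs w ≤_) b≡2 (count-∧≤ (is c6bar) (λ b → occurs b w) bs))) (sym b≡2)
    open Saturated bs c6bar saturated
    3≰2 : ¬ (3 ≤ 2)
    3≰2 (s≤s (s≤s ()))

-- K_10: with a leave of fewer than 3 edges all 45 edges are covered, by six C₆'s
-- and one C̄₆ or by three of each.  A vertex has degree 9 = 2x + 3y.  In the first
-- case y = 1 at every vertex, so all ten vertices lie on the single C̄₆.  In the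
-- second case x ∈ {0, 3}, so all three C₆'s have the same six vertices, impossible
-- by the local pigeonhole principle (2 + 2 neighbours, 5 - 2 free positions).
sizes-K10 : ∀ a b L → a * 6 + b * 9 + L ≡ 45 → 1 ≤ a → 1 ≤ b → L < 3 → L ≡ 0 × (b ≡ 1 ⊎ a ≡ 3)
sizes-K10 = LinearSolutions.solutions 6 9 45
  (λ a b L → (1 ≤? a) →-dec (1 ≤? b) →-dec (L <? 3) →-dec ((L ≟ 0) ×-dec ((b ≟ 1) ⊎-dec (a ≟ 3))))

degrees-K10-C̄₆ : ∀ x y r → x * 2 + y * 3 + r ≡ 10 → r ≡ 1 → y ≤ 1 → y ≡ 1
degrees-K10-C̄₆ = LinearSolutions.solutions 2 3 10 (λ x y r → (r ≟ 1) →-dec (y ≤? 1) →-dec (y ≟ 1))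

degrees-K10-C₆ : ∀ x y r → x * 2 + y * 3 + r ≡ 10 → r ≡ 1 → 1 ≤ x → x ≤ 3 → x ≡ 3
degrees-K10-C₆ = LinearSolutions.solutions 2 3 10 (λ x y r → (r ≟ 1) →-dec (1 ≤? x) →-dec (x ≤? 3) →-dec (x ≟ 3))

lower-bound-K10 : (M : Multipacking 10) → 3 ≤ leaveSize M
lower-bound-K10 M = ℕₚ.≮⇒≥ λ L<3 → case-split (sizes-K10 _ _ _ (edge-count M) #C₆≥1 #C̄₆≥1 L<3)
  where
  open Copies M
  one-C̄₆-impossible : leaveSize M ≡ 0 → #C̄₆ ≡ 1 → ⊥
  one-C̄₆-impossible L≡0 b≡1 with some-C̄₆
  ... | B , mB , kB with Fₚ.pigeonhole (s≤s (s≤s (s≤s (s≤s (s≤s (s≤s (s≤s z≤n))))))) (position B)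
  ...   | i , j , i<j , same = Fₚ.<-irrefl (trans (sym (on-B i)) (trans (cong (place B) same) (on-B j))) i<j
    where
    on-B : ∀ w → place B (position B w) ≡ w
    on-B w = position-spec B w (count-∧-full (is c6bar) (λ b → occurs b w) bs
      (trans (degrees-K10-C̄₆ (copiesAt c6 bs w) _ _ (degree-identity M L≡0 w) refl
         (subst (copiesAt c6bar bs w ≤_) b≡1 (count-∧≤ (is c6bar) (λ b → occurs b w) bs))) (sym b≡1))
      B mB kB)

  three-C₆-impossible : leaveSize M ≡ 0 → #C₆ ≡ 3 → ⊥
  three-C₆-impossible L≡0 a≡3 with triple-of (is c6) (pairwise-disjoint M) (ℕₚ.≤-reflexive (sym a≡3))
  ... | H , B , B′ , mH , mB , mB′ , kH , kB , kB′ , H∩B , H∩B′ , B∩B′ =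
    4≰3 (subst₂ (λ d e → d ≤ 5 ∸ e) (cong₂ _+_ (kind-of c6 B kB) (kind-of c6 B′ kB′)) (kind-of c6 H kH)
      (LocalPigeonhole.inside-two H w B B′ H∩B H∩B′ B∩B′ (same-vertices mB kB mH kH) (same-vertices mB′ kB′ mH kH)
         (occurs-complete B refl) (through-all w mB kB (occurs-complete B refl) mB′ kB′)))
    where
    w : Fin 10
    w = place B zero
    saturated : ∀ w → 1 ≤ copiesAt c6 bs w → copiesAt c6 bs w ≡ #C₆
    saturated w pos = trans (degrees-K10-C₆ _ (copiesAt c6bar bs w) _ (degree-identity M L≡0 w) refl pos
      (subst (copiesAt c6 bs w ≤_) a≡3 (count-∧≤ (is c6) (λ b → occurs b w) bs))) (sym a≡3)
    open Saturated bs c6 saturated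
    4≰3 : ¬ (4 ≤ 3)
    4≰3 (s≤s (s≤s (s≤s ())))

  case-split : leaveSize M ≡ 0 × (#C̄₆ ≡ 1 ⊎ #C₆ ≡ 3) → ⊥
  case-split (L≡0 , inj₁ b≡1) = one-C̄₆-impossible L≡0 b≡1
  case-split (L≡0 , inj₂ a≡3) = three-C₆-impossible L≡0 a≡3

K7 : WithLeave 7 6
K7 = multipacking K7-blocks (toWitness {a? = pairwise-disjoint? K7-blocks} _) (there (here refl)) (here refl) , refl
  where
  K7-blocks : List (Block 7)
  K7-blocks = copy c6bar (# 0 ∷ # 1 ∷ # 4 ∷ # 6 ∷ # 2 ∷ # 3 ∷ [])
            ∷ copy c6 (# 0 ∷ # 2 ∷ # 4 ∷ # 5 ∷ # 1 ∷ # 3 ∷ []) ∷ []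

K9 : WithLeave 9 3
K9 = multipacking K9-blocks (toWitness {a? = pairwise-disjoint? K9-blocks} _)
                  (here refl) (there (there (there (there (here refl))))) , refl
  where
  K9-blocks : List (Block 9)
  K9-blocks = copy c6 (# 0 ∷ # 1 ∷ # 3 ∷ # 7 ∷ # 8 ∷ # 5 ∷ [])
            ∷ copy c6 (# 0 ∷ # 2 ∷ # 6 ∷ # 3 ∷ # 4 ∷ # 8 ∷ [])
            ∷ copy c6 (# 0 ∷ # 3 ∷ # 2 ∷ # 8 ∷ # 1 ∷ # 4 ∷ [])
            ∷ copy c6 (# 0 ∷ # 6 ∷ # 8 ∷ # 3 ∷ # 5 ∷ # 7 ∷ [])
            ∷ copy c6bar (# 1 ∷ # 2 ∷ # 5 ∷ # 6 ∷ # 7 ∷ # 4 ∷ []) ∷ []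

K10 : WithLeave 10 3
K10 = multipacking K10-blocks (toWitness {a? = pairwise-disjoint? K10-blocks} _) (here refl) (there (here refl)) , refl
  where
  K10-blocks : List (Block 10)
  K10-blocks = copy c6 (# 0 ∷ # 1 ∷ # 5 ∷ # 3 ∷ # 2 ∷ # 7 ∷ [])
             ∷ copy c6bar (# 0 ∷ # 2 ∷ # 6 ∷ # 4 ∷ # 1 ∷ # 8 ∷ [])
             ∷ copy c6 (# 0 ∷ # 3 ∷ # 6 ∷ # 9 ∷ # 7 ∷ # 5 ∷ [])
             ∷ copy c6 (# 0 ∷ # 8 ∷ # 7 ∷ # 3 ∷ # 1 ∷ # 9 ∷ [])
             ∷ copy c6 (# 1 ∷ # 6 ∷ # 5 ∷ # 9 ∷ # 4 ∷ # 7 ∷ [])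
             ∷ copy c6bar (# 2 ∷ # 4 ∷ # 5 ∷ # 9 ∷ # 3 ∷ # 8 ∷ []) ∷ []

theorem2 : ((n : ℕ) → n % 3 ≡ 2 → 8 ≤ n → MaxLeave n 1)
           × MaxLeave 7 6 × MaxLeave 9 3 × MaxLeave 10 3
theorem2 = (λ n n%3≡2 8≤n → leave-one n n%3≡2 8≤n , leave-nonempty n n%3≡2)
         , (K7 , lower-bound-K7)
         , (K9 , lower-bound-K9)
         , (K10 , lower-bound-K10)
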